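{- Let $S$, $\Pi_1$, $U$, $\Delta$, $sw$, $U_T$, $\mathbf{W}$, $\mathcal{P}$, $I$ and $M(S)$ be as in the context, and suppose that $|\Pi_1|$ is odd and $3\leq |\Pi_1|\leq n-3$. For $1\le i\le 4$ put $$A_i:=\{j\in[n]~|~j\equiv i \text{ or } j\equiv n+|\Pi_1|-i \pmod{4}\}.$$ Then the nontrivial orbits of $F_2^n$ under $\mathbf{W}$ are $U_{A_1}, U_{A_2}, U_{A_3}, U_{A_4}$ (some of these may coincide). In particular, the number of orbits (including the trivial orbit $\{0\}$) is $$|\mathcal{P}|=\begin{cases}3, & \text{if } n \text{ is even};\\ 4, & \text{if } n \text{ is odd},\end{cases}$$ and $$M(S)=\begin{cases}1, & \text{if } A_i\cap I\neq\emptyset \text{ for all } 1\le i\le 4;\\ 2, & \text{otherwise.}\end{cases}$$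
   Context: $S$ is a finite simple connected graph with vertex set $\{s_1,\dots,s_n\}$, $n\ge 2$, and edge set $R$, such that $s_1,s_2,\dots,s_{n-1}$ is an induced path ($s_i\sim s_{i+1}$ and no other edges among $s_1,\dots,s_{n-1}$). The neighbours of $s_n$ are $s_{j_1},\dots,s_{j_m}$ with $1\le j_1<\dots<j_m\le n-1$. Vectors in $F_2^n$ (column vectors over the two-element field) have coordinates indexed by the vertices. For a vertex $s$, $\widetilde{s}$ is its characteristic vector. For each vertex $s$ the flipping move $\mathbf{s}\in \mathrm{Mat}_n(F_2)$ has entries $\mathbf{s}_{ab}=1$ if $a=b$, or if $b=s$ and $ab\in R$, and $\mathbf{s}_{ab}=0$ otherwise. Thus $\mathbf{s}\widetilde{b}=\widetilde{b}$ for $b\ne s$, and $\mathbf{s}\widetilde{s}=\widetilde{s}+\sum_{a:\,as\in R}\widetilde{a}$. The flipping group $\mathbf{W}$ is the subgroup of $\mathrm{GL}_n(F_2)$ generated by $\mathbf{s_1},\dots,\mathbf{s_n}$. It acts on $F_2^n$ by left multiplication, and its orbits are exactly the equivalence classes of the lit-only flipping puzzle on $S$. $\mathcal{P}$ denotes the set of these orbits; $\{0\}$ is the trivial orbit. Define $\overline{1}=\widetilde{s}_1$ and $\overline{i+1}=\mathbf{s_i}\mathbf{s_{i-1}}\cdots\mathbf{s_1}\overline{1}$ for $1\le i\le n-1$. Set $\Pi=\{\overline{1},\dots,\overline{n}\}$, $\Pi_0=\{\overline{i}\in\Pi:\langle\overline{i},\widetilde{s}_n\rangle=0\}$ (standard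 dot product over $F_2$), and $\Pi_1=\Pi\setminus\Pi_0$. For $0\le i\le n$ let $[\overline{i}]=\{\overline{1},\dots,\overline{i}\}$, with $[\overline{0}]=\emptyset$. $U$ is the span of $\Pi$; when $|\Pi_1|$ is odd, $U=F_2^n$. $\Delta=\Pi$ when $|\Pi_1|$ is odd; this is a basis of $F_2^n$. For $u\in F_2^n$, $\Delta(u)$ is the unique subset of $\Delta$ with $u=\sum_{x\in\Delta(u)}x$, and the simple weight is $sw(u)=|\Delta(u)|$. For $V\subseteq F_2^n$ and $T\subseteq\{0,\dots,n\}$, $V_T=\{u\in V: sw(u)\in T\}$. $[n]=\{1,\dots,n\}$. $w(u)$ is the Hamming weight of $u$. For $O\in\mathcal{P}$, $w(O)=\min_{u\in O}w(u)$, and $M(S)=\max_{O\in\mathcal{P}}w(O)$. When $|\Pi_1|$ is odd, $I=\{i\in[n]: |[\overline{i}]\cap\Pi_1| \text{ is even, or } i=n, \text{ or } |[\overline{n-i}]\cap\Pi_1| \text{ is odd}\}$. -}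

module Defs where

open import Data.Bool using (Bool; true; false; _∧_; _∨_; _xor_; if_then_else_; T)
open import Data.Nat using (ℕ; zero; suc; _+_; _∸_; _≤_; _<_; _≡ᵇ_; _<ᵇ_; _%_; s≤s)
open import Data.Nat.Properties using (≤-trans; n≤1+n)
open import Data.Fin using (Fin; toℕ; fromℕ<)
open import Data.Fin.Properties using (toℕ<n)
open import Data.List using (List; []; _∷_; foldr)
open import Data.Product using (Σ; _×_; _,_; ∃)
open import Data.Sum using (_⊎_)
open import Relation.Binary.PropositionalEquality using (_≡_)

-- A vector of F₂ⁿ : coordinates indexed by the vertices (Fin n, vertex sᵢ ↦ index i-1).
Vec₂ : ℕ → Set
Vec₂ n = Fin n → Bool

_≈_ : ∀ {n} → Vec₂ n → Vec₂ n → Set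
u ≈ v = ∀ a → u a ≡ v a

zeroV : ∀ {n} → Vec₂ n
zeroV _ = false

_⊕_ : ∀ {n} → Vec₂ n → Vec₂ n → Vec₂ n
(u ⊕ v) a = u a xor v a

countTrue : ∀ {k} → (Fin k → Bool) → ℕ
countTrue {zero} f = 0
countTrue {suc k} f = (if f Fin.zero then 1 else 0) + countTrue (λ i → f (Fin.suc i))

weight : ∀ {n} → Vec₂ n → ℕ
weight = countTrue

parity : ℕ → Bool
parity n = n % 2 ≡ᵇ 1

dot : ∀ {n} → Vec₂ n → Vec₂ n → Bool
dot u v = parity (countTrue (λ a → u a ∧ v a))

sumSel : ∀ {n k} → (Fin k → Bool) → (Fin k → Vec₂ n) → Vec₂ n
sumSel {k = zero} c x = zeroV
sumSel {k = suc k} c x =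
  (if c Fin.zero then x Fin.zero else zeroV) ⊕ sumSel (λ i → c (Fin.suc i)) (λ i → x (Fin.suc i))

record Graph (n : ℕ) : Set where
  field
    adj    : Fin n → Fin n → Bool
    sym    : ∀ a b → adj a b ≡ adj b a
    irrefl : ∀ a → adj a a ≡ false
open Graph public

data Walk {n} (S : Graph n) : Fin n → Fin n → Set where
  here : ∀ {a} → Walk S a a
  step : ∀ {a b c} → adj S a b ≡ true → Walk S b c → Walk S a c

Connected : ∀ {n} → Graph n → Set
Connected S = ∀ a b → Walk S a b

-- s₁,…,s_{n-1} (indices 0,…,n-2) is an induced path: for a,b among them,
-- a ~ b  iff  |a - b| = 1
InducedPathPrefix : ∀ {n} → Graph n → Set
InducedPathPrefix {n} S =
  ∀ (a b : Fin n) → suc (toℕ a) < n → suc (toℕ b) < n →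
    adj S a b ≡ ((suc (toℕ a) ≡ᵇ toℕ b) ∨ (suc (toℕ b) ≡ᵇ toℕ a))

chr : ∀ {n} → Fin n → Vec₂ n
chr b a = toℕ a ≡ᵇ toℕ b

chrLast : ∀ {n} → Vec₂ n
chrLast {n} a = toℕ a ≡ᵇ (n ∸ 1)

-- the flipping move 𝐬 applied to v:  (𝐬 v)_a = Σ_b 𝐬_{ab} v_b = v_a + [a s ∈ R] v_s
flip : ∀ {n} → Graph n → Fin n → Vec₂ n → Vec₂ n
flip S s v a = v a xor (adj S a s ∧ v s)

applyWord : ∀ {n} → Graph n → List (Fin n) → Vec₂ n → Vec₂ n
applyWord S ws v = foldr (flip S) v ws

-- v lies in the 𝐖-orbit of u  (𝐖 generated by involutions, so every element is a word)
Reach : ∀ {n} → Graph n → Vec₂ n → Vec₂ n → Set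
Reach S u v = ∃ λ (ws : List _) → applyWord S ws u ≈ v

-- The vectors 1̄, …, n̄.   piN S k p = \overline{k+1}

piN : ∀ {n} → Graph n → (k : ℕ) → k < n → Vec₂ n
piN S zero p = chr (fromℕ< p)
piN S (suc k) p = flip S (fromℕ< q) (piN S k q)
  where q = ≤-trans (n≤1+n (suc k)) p

pi : ∀ {n} → Graph n → Fin n → Vec₂ n
pi S f = piN S (toℕ f) (toℕ<n f)

inΠ₁ : ∀ {n} → Graph n → Fin n → Bool
inΠ₁ S f = dot (pi S f) chrLast

cntΠ₁ : ∀ {n} → Graph n → ℕ → ℕ
cntΠ₁ S i = countTrue (λ f → (toℕ f <ᵇ i) ∧ inΠ₁ S f)

sizeΠ₁ : ∀ {n} → Graph n → ℕ
sizeΠ₁ {n} S = cntΠ₁ S n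

-- U_T = { u : sw(u) ∈ T }, with Δ = Π (c is the indicator of Δ(u))
InU : ∀ {n} → Graph n → (ℕ → Set) → Vec₂ n → Set
InU S T u = Σ (Fin _ → Bool) λ c → (sumSel c (pi S) ≈ u) × T (countTrue c)

A : ∀ {n} → Graph n → ℕ → ℕ → Set
A {n} S i j = (1 ≤ j × j ≤ n) ×
  ((j % 4 ≡ i % 4) ⊎ ((j + i) % 4 ≡ (n + sizeΠ₁ S) % 4))

Iset : ∀ {n} → Graph n → ℕ → Set
Iset {n} S i = (1 ≤ i × i ≤ n) ×
  ((parity (cntΠ₁ S i) ≡ false) ⊎ (i ≡ n) ⊎ (parity (cntΠ₁ S (n ∸ i)) ≡ true))

-- |𝒫| = k : there are k representatives, in pairwise distinct orbits, meeting every orbit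
NumOrbits : ∀ {n} → Graph n → ℕ → Set
NumOrbits {n} S k = Σ (Fin k → Vec₂ n) λ r →
  (∀ i j → Reach S (r i) (r j) → i ≡ j) × (∀ u → ∃ λ i → Reach S (r i) u)

-- M(S) = m  (max over orbits O of min_{u∈O} w(u) equals m):
-- every orbit contains a vector of weight ≤ m, and some orbit has all weights ≥ m
MaxMinWeight : ∀ {n} → Graph n → ℕ → Set
MaxMinWeight {n} S m =
  (∀ u → ∃ λ v → Reach S u v × weight v ≤ m) ×
  (∃ λ u → ∀ v → Reach S u v → m ≤ weight v)

module Submission where

-- Write vectors in the basis Π = {\overline{1}, …, \overline{n}}, which is a basis because |Π₁| is
-- odd. The move at a path vertex sᵢ₊₁ exchanges \overline{i+1} and \overline{i+2}, so it permutes
-- coordinates; the move at sₙ does nothing unless sₙ is lit, and then adds the sum of Π₀. A lit sₙ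
-- means an odd number t of coordinates in Π₁, and the move turns simple weight j into
-- 2t + |Π₀| − j ≡ n + |Π₁| − j (mod 4). So the classes Aᵢ are invariant. Conversely, sorting the
-- coordinates reaches \overline{1} + ⋯ + \overline{j}, and two of the reflections
-- j ↦ 2t + |Π₀| − j compose to j ↦ j ± 4 (here |Π₁|, |Π₀| ≥ 3 are used), so each Aᵢ is a single
-- orbit. For M(S): a unit vector has simple weight in I and every element of I arises this way,
-- while \overline{1} + ⋯ + \overline{i} has weight at most 2.

open import Algebra.Bundles using (CommutativeRing)
open import Data.Bool using (Bool; true; false; _∧_; _∨_; _xor_; if_then_else_; T; not)
open import Data.Bool.Properties
  using (xor-same; xor-assoc; xor-identityʳ; xor-annihilates-not; xor-∧-commutativeRing;
         ∧-distribˡ-xor; ∧-distribʳ-xor; ∧-zeroʳ; ∧-identityʳ; not-distribˡ-xor; T-∨)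
  renaming (_≟_ to _≟ᴮ_)
open import Data.Empty using (⊥-elim)
open import Data.Fin using (Fin; toℕ; fromℕ<) renaming (zero to fzero; suc to fsuc)
open import Data.Fin.Properties using (toℕ-fromℕ<; fromℕ<-toℕ; toℕ<n; toℕ-injective; any?)
open import Data.List using (List; []; _∷_; [_]; length; _++_; replicate; map; zipWith; reverse)
open import Data.List.Properties using (foldr-++; unfold-reverse)
open import Data.Nat using (ℕ; zero; suc; _+_; _*_; _∸_; _≤_; _<_; _≡ᵇ_; _<ᵇ_; _%_; s≤s; z≤n; _<?_; _≤?_; _≟_)
open import Data.Nat.DivMod using (%-distribˡ-+; [m+kn]%n≡m%n; m<n⇒m%n≡m)
open import Data.Nat.Properties
open import Data.Nat.Tactic.RingSolver using (solve-∀)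
open import Data.Product using (Σ; _×_; _,_; ∃; proj₁; proj₂)
open import Function using (_∘_; _$_)
open import Function.Bundles using (Equivalence)
open import Data.Sum using (_⊎_; inj₁; inj₂)
open import Relation.Binary.PropositionalEquality hiding ([_])
open import Relation.Nullary using (¬_; yes; no; Dec)
open import Relation.Nullary.Decidable using (_×-dec_; _⊎-dec_)

open import Defs hiding (sym)
open import Algebra.Properties.CommutativeSemigroup
  (CommutativeRing.+-commutativeSemigroup xor-∧-commutativeRing)
  using (interchange) renaming (x∙yz≈y∙xz to xor-leftComm)

xor-cancelˡ : ∀ a b → a xor (a xor b) ≡ b
xor-cancelˡ a b = trans (sym (xor-assoc a a b)) (cong (_xor b) (xor-same a))

xor≡false⇒≡ : ∀ {a b} → a xor b ≡ false → a ≡ b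
xor≡false⇒≡ {true}  {true}  _ = refl
xor≡false⇒≡ {false} {false} _ = refl

≡⇒xor≡false : ∀ {a b} → a ≡ b → a xor b ≡ false
≡⇒xor≡false {a} refl = xor-same a

not-∧ : ∀ x y → not x ∧ y ≡ y xor (x ∧ y)
not-∧ true  true  = refl
not-∧ true  false = refl
not-∧ false y     = sym (xor-identityʳ y)

true≢false : true ≢ false
true≢false ()

≡ᵇ-refl : ∀ m → (m ≡ᵇ m) ≡ true
≡ᵇ-refl zero    = refl
≡ᵇ-refl (suc m) = ≡ᵇ-refl m

≢⇒≡ᵇ-false : ∀ m n → m ≢ n → (m ≡ᵇ n) ≡ false
≢⇒≡ᵇ-false zero    zero    m≢n = ⊥-elim (m≢n refl)
≢⇒≡ᵇ-false zero    (suc n) _   = refl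
≢⇒≡ᵇ-false (suc m) zero    _   = refl
≢⇒≡ᵇ-false (suc m) (suc n) m≢n = ≢⇒≡ᵇ-false m n (m≢n ∘ cong suc)

≡ᵇ-true⇒≡ : ∀ m n → (m ≡ᵇ n) ≡ true → m ≡ n
≡ᵇ-true⇒≡ m n e = ≡ᵇ⇒≡ m n (subst T (sym e) _)

≡ᵇ-sym : ∀ m n → (m ≡ᵇ n) ≡ (n ≡ᵇ m)
≡ᵇ-sym zero    zero    = refl
≡ᵇ-sym zero    (suc n) = refl
≡ᵇ-sym (suc m) zero    = refl
≡ᵇ-sym (suc m) (suc n) = ≡ᵇ-sym m n

<⇒<ᵇ-true : ∀ m n → m < n → (m <ᵇ n) ≡ true
<⇒<ᵇ-true zero    (suc n) _         = refl
<⇒<ᵇ-true (suc m) (suc n) (s≤s m<n) = <⇒<ᵇ-true m n m<n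

≥⇒<ᵇ-false : ∀ m n → n ≤ m → (m <ᵇ n) ≡ false
≥⇒<ᵇ-false m       zero    _         = refl
≥⇒<ᵇ-false (suc m) (suc n) (s≤s n≤m) = ≥⇒<ᵇ-false m n n≤m

<ᵇ-suc-xor : ∀ x m → (x <ᵇ suc m) xor (suc x <ᵇ suc m) ≡ (x ≡ᵇ m)
<ᵇ-suc-xor zero    zero    = refl
<ᵇ-suc-xor zero    (suc m) = refl
<ᵇ-suc-xor (suc x) zero    = refl
<ᵇ-suc-xor (suc x) (suc m) = <ᵇ-suc-xor x m

parity-suc : ∀ k → parity (suc k) ≡ not (parity k)
parity-suc zero                = refl
parity-suc (suc zero)          = refl
parity-suc (suc (suc k))       = parity-suc k

parity-+ : ∀ x y → parity (x + y) ≡ parity x xor parity y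
parity-+ zero    y = refl
parity-+ (suc x) y = begin
  parity (suc x + y)            ≡⟨ parity-suc (x + y) ⟩
  not (parity (x + y))          ≡⟨ cong not (parity-+ x y) ⟩
  not (parity x xor parity y)   ≡⟨ not-distribˡ-xor (parity x) (parity y) ⟩
  not (parity x) xor parity y   ≡⟨ cong (_xor parity y) (sym (parity-suc x)) ⟩
  parity (suc x) xor parity y   ∎
  where open ≡-Reasoning

parity-double : ∀ a → parity (a + a) ≡ false
parity-double a = trans (parity-+ a a) (xor-same (parity a))

parity-odd : ∀ a → parity (suc (a + a)) ≡ true
parity-odd a = trans (parity-suc (a + a)) (cong not (parity-double a))

even-or-odd : ∀ m → (Σ ℕ λ a → m ≡ a + a) ⊎ (Σ ℕ λ a → m ≡ suc (a + a))
even-or-odd zero = inj₁ (0 , refl)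
even-or-odd (suc m) with even-or-odd m
... | inj₁ (a , e) = inj₂ (a , cong suc e)
... | inj₂ (a , e) = inj₁ (suc a , trans (cong suc e) (cong suc (sym (+-suc a a))))

parity-true⇒odd : ∀ m → parity m ≡ true → Σ ℕ λ a → m ≡ suc (a + a)
parity-true⇒odd m e with even-or-odd m
... | inj₂ odd      = odd
... | inj₁ (a , refl) = ⊥-elim (true≢false (trans (sym e) (parity-double a)))

parity-%4 : ∀ x → parity (x % 4) ≡ parity x
parity-%4 0 = refl
parity-%4 1 = refl
parity-%4 2 = refl
parity-%4 3 = refl
parity-%4 (suc (suc (suc (suc x)))) = parity-%4 x

ones : List Bool → ℕ
ones []       = 0
ones (b ∷ bs) = (if b then 1 else 0) + ones bs

Σ₂ : List Bool → Bool
Σ₂ []       = false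
Σ₂ (b ∷ bs) = b xor Σ₂ bs

Σ₂≡parity-ones : ∀ bs → Σ₂ bs ≡ parity (ones bs)
Σ₂≡parity-ones []           = refl
Σ₂≡parity-ones (true ∷ bs)  = trans (cong not (Σ₂≡parity-ones bs)) (sym (parity-suc (ones bs)))
Σ₂≡parity-ones (false ∷ bs) = Σ₂≡parity-ones bs

ones≤length : ∀ bs → ones bs ≤ length bs
ones≤length []           = z≤n
ones≤length (true ∷ bs)  = s≤s (ones≤length bs)
ones≤length (false ∷ bs) = m≤n⇒m≤1+n (ones≤length bs)

ones-map-not : ∀ bs → ones (map not bs) + ones bs ≡ length bs
ones-map-not []           = refl
ones-map-not (true ∷ bs)  = trans (+-suc _ _) (cong suc (ones-map-not bs))
ones-map-not (false ∷ bs) = cong suc (ones-map-not bs)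

xorᴸ andᴸ : List Bool → List Bool → List Bool
xorᴸ = zipWith _xor_
andᴸ = zipWith _∧_

length-xorᴸ : ∀ bs cs → length bs ≡ length cs → length (xorᴸ bs cs) ≡ length bs
length-xorᴸ []       []       _ = refl
length-xorᴸ (b ∷ bs) (c ∷ cs) e = cong suc (length-xorᴸ bs cs (suc-injective e))

ones-xor-not : ∀ bs g → length bs ≡ length g →
  ones (xorᴸ bs (map not g)) + ones bs ≡ ones (andᴸ bs g) + ones (andᴸ bs g) + ones (map not g)
ones-xor-not []           []          _ = refl
ones-xor-not (true ∷ bs)  (true ∷ g)  e
  rewrite +-suc (ones (xorᴸ bs (map not g))) (ones bs) | +-suc (ones (andᴸ bs g)) (ones (andᴸ bs g))
  = cong (suc ∘ suc) (ones-xor-not bs g (suc-injective e))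
ones-xor-not (true ∷ bs)  (false ∷ g) e
  rewrite +-suc (ones (xorᴸ bs (map not g))) (ones bs) | +-suc (ones (andᴸ bs g) + ones (andᴸ bs g)) (ones (map not g))
  = cong suc (ones-xor-not bs g (suc-injective e))
ones-xor-not (false ∷ bs) (true ∷ g)  e = ones-xor-not bs g (suc-injective e)
ones-xor-not (false ∷ bs) (false ∷ g) e
  rewrite +-suc (ones (andᴸ bs g) + ones (andᴸ bs g)) (ones (map not g))
  = cong suc (ones-xor-not bs g (suc-injective e))

ones-and≤ones-xor-not : ∀ bs g → ones (andᴸ bs g) ≤ ones (xorᴸ bs (map not g))
ones-and≤ones-xor-not []           _           = z≤n
ones-and≤ones-xor-not (_ ∷ _)      []          = z≤n
ones-and≤ones-xor-not (true ∷ bs)  (true ∷ g)  = s≤s (ones-and≤ones-xor-not bs g)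
ones-and≤ones-xor-not (true ∷ bs)  (false ∷ g) = ones-and≤ones-xor-not bs g
ones-and≤ones-xor-not (false ∷ bs) (true ∷ g)  = ones-and≤ones-xor-not bs g
ones-and≤ones-xor-not (false ∷ bs) (false ∷ g) = m≤n⇒m≤1+n (ones-and≤ones-xor-not bs g)

slice : (ℕ → Bool) → ℕ → ℕ → List Bool
slice f o zero    = []
slice f o (suc m) = f o ∷ slice f (suc o) m

length-slice : ∀ f o m → length (slice f o m) ≡ m
length-slice f o zero    = refl
length-slice f o (suc m) = cong suc (length-slice f (suc o) m)

slice-cong : ∀ f g o m → (∀ j → o ≤ j → j < o + m → f j ≡ g j) → slice f o m ≡ slice g o m
slice-cong f g o zero    h = refl
slice-cong f g o (suc m) h =
  cong₂ _∷_ (h o ≤-refl (subst (o <_) (sym (+-suc o m)) (s≤s (m≤m+n o m))))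
    (slice-cong f g (suc o) m (λ j o<j j<o+m → h j (<⇒≤ o<j) (subst (j <_) (sym (+-suc o m)) j<o+m)))

map-not-slice : ∀ f o m → map not (slice f o m) ≡ slice (not ∘ f) o m
map-not-slice f o zero    = refl
map-not-slice f o (suc m) = cong (not (f o) ∷_) (map-not-slice f (suc o) m)

ones-slice-true : ∀ o m → ones (slice (λ _ → true) o m) ≡ m
ones-slice-true o zero    = refl
ones-slice-true o (suc m) = cong suc (ones-slice-true (suc o) m)

ones-slice-false : ∀ o m → ones (slice (λ _ → false) o m) ≡ 0
ones-slice-false o zero    = refl
ones-slice-false o (suc m) = ones-slice-false (suc o) m

ones-slice-< : ∀ m N o → m ≤ N → ones (slice (λ j → j <ᵇ o + m) o N) ≡ m
ones-slice-< zero    N       o _ =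
  trans (cong ones (slice-cong _ _ o N (λ j o≤j _ → ≥⇒<ᵇ-false j (o + 0) (subst (_≤ j) (sym (+-identityʳ o)) o≤j))))
        (ones-slice-false o N)
ones-slice-< (suc m) (suc N) o (s≤s m≤N)
  rewrite <⇒<ᵇ-true o (o + suc m) (subst (o <_) (sym (+-suc o m)) (s≤s (m≤m+n o m))) =
  cong suc (trans (cong ones (slice-cong _ _ (suc o) N (λ j _ _ → cong (j <ᵇ_) (+-suc o m))))
                  (ones-slice-< m N (suc o) m≤N))

at : List Bool → ℕ → ℕ → Bool
at []       o j = false
at (b ∷ bs) o j = if j ≡ᵇ o then b else at bs (suc o) j

slice-at : ∀ bs o → slice (at bs o) o (length bs) ≡ bs
slice-at []       o = refl
slice-at (b ∷ bs) o rewrite ≡ᵇ-refl o =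
  cong (b ∷_) (trans (slice-cong _ _ (suc o) (length bs) (λ j o<j _ → skip j o<j)) (slice-at bs (suc o)))
  where skip : ∀ j → suc o ≤ j → (if j ≡ᵇ o then b else at bs (suc o) j) ≡ at bs (suc o) j
        skip j o<j rewrite ≢⇒≡ᵇ-false j o (λ e → <-irrefl (sym e) o<j) = refl

≡slice-at : ∀ bs {m} → length bs ≡ m → bs ≡ slice (at bs 0) 0 m
≡slice-at bs refl = sym (slice-at bs 0)

swapAt : ℕ → List Bool → List Bool
swapAt zero    (a ∷ b ∷ r) = b ∷ a ∷ r
swapAt zero    r           = r
swapAt (suc i) []          = []
swapAt (suc i) (a ∷ r)     = a ∷ swapAt i r

length-swapAt : ∀ i bs → length (swapAt i bs) ≡ length bs
length-swapAt zero    []          = refl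
length-swapAt zero    (a ∷ [])    = refl
length-swapAt zero    (a ∷ b ∷ r) = refl
length-swapAt (suc i) []          = refl
length-swapAt (suc i) (a ∷ r)     = cong suc (length-swapAt i r)

ones-swapAt : ∀ i bs → ones (swapAt i bs) ≡ ones bs
ones-swapAt zero    []          = refl
ones-swapAt zero    (a ∷ [])    = refl
ones-swapAt zero    (a ∷ b ∷ r) = begin
  (if b then 1 else 0) + ((if a then 1 else 0) + ones r)   ≡⟨ sym (+-assoc (if b then 1 else 0) _ _) ⟩
  ((if b then 1 else 0) + (if a then 1 else 0)) + ones r   ≡⟨ cong (_+ ones r) (+-comm (if b then 1 else 0) _) ⟩
  ((if a then 1 else 0) + (if b then 1 else 0)) + ones r   ≡⟨ +-assoc (if a then 1 else 0) _ _ ⟩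
  (if a then 1 else 0) + ((if b then 1 else 0) + ones r)   ∎
  where open ≡-Reasoning
ones-swapAt (suc i) []          = refl
ones-swapAt (suc i) (a ∷ r)     = cong ((if a then 1 else 0) +_) (ones-swapAt i r)

choose : List Bool → ℕ → ℕ → List Bool
choose []          t       s       = []
choose (true ∷ g)  zero    s       = false ∷ choose g zero s
choose (true ∷ g)  (suc t) s       = true ∷ choose g t s
choose (false ∷ g) t       zero    = false ∷ choose g t zero
choose (false ∷ g) t       (suc s) = true ∷ choose g t s

length-choose : ∀ g t s → length (choose g t s) ≡ length g
length-choose []          t       s       = refl
length-choose (true ∷ g)  zero    s       = cong suc (length-choose g zero s)
length-choose (true ∷ g)  (suc t) s       = cong suc (length-choose g t s)
length-choose (false ∷ g) t       zero    = cong suc (length-choose g t zero)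
length-choose (false ∷ g) t       (suc s) = cong suc (length-choose g t s)

ones-and-choose : ∀ g t s → t ≤ ones g → ones (andᴸ (choose g t s) g) ≡ t
ones-and-choose []          zero    s       _         = refl
ones-and-choose (true ∷ g)  zero    s       _         = ones-and-choose g zero s z≤n
ones-and-choose (true ∷ g)  (suc t) s       (s≤s t≤g) = cong suc (ones-and-choose g t s t≤g)
ones-and-choose (false ∷ g) t       zero    t≤g       = ones-and-choose g t zero t≤g
ones-and-choose (false ∷ g) t       (suc s) t≤g       = ones-and-choose g t s t≤g

ones-choose : ∀ g t s → t ≤ ones g → s ≤ ones (map not g) → ones (choose g t s) ≡ t + s
ones-choose []          zero    zero    _         _         = refl
ones-choose (true ∷ g)  zero    s       _         s≤        = ones-choose g zero s z≤n s≤
ones-choose (true ∷ g)  (suc t) s       (s≤s t≤g) s≤        = cong suc (ones-choose g t s t≤g s≤)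
ones-choose (false ∷ g) t       zero    t≤g       _         = ones-choose g t zero t≤g z≤n
ones-choose (false ∷ g) t       (suc s) t≤g       (s≤s s≤)  =
  trans (cong suc (ones-choose g t s t≤g s≤)) (sym (+-suc t s))

toListᶠ : ∀ {m} → (Fin m → Bool) → List Bool
toListᶠ {zero}  c = []
toListᶠ {suc m} c = c fzero ∷ toListᶠ (c ∘ fsuc)

length-toListᶠ : ∀ {m} (c : Fin m → Bool) → length (toListᶠ c) ≡ m
length-toListᶠ {zero}  c = refl
length-toListᶠ {suc m} c = cong suc (length-toListᶠ (c ∘ fsuc))

toListᶠ-cong : ∀ {m} {c d : Fin m → Bool} → (∀ i → c i ≡ d i) → toListᶠ c ≡ toListᶠ d
toListᶠ-cong {zero}  h = refl
toListᶠ-cong {suc m} h = cong₂ _∷_ (h fzero) (toListᶠ-cong (h ∘ fsuc))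

countTrue≡ones : ∀ {m} (c : Fin m → Bool) → countTrue c ≡ ones (toListᶠ c)
countTrue≡ones {zero}  c = refl
countTrue≡ones {suc m} c = cong ((if c fzero then 1 else 0) +_) (countTrue≡ones (c ∘ fsuc))

countTrue-cong : ∀ {m} {c d : Fin m → Bool} → (∀ i → c i ≡ d i) → countTrue c ≡ countTrue d
countTrue-cong {c = c} {d} h = trans (countTrue≡ones c) (trans (cong ones (toListᶠ-cong h)) (sym (countTrue≡ones d)))

fromListᶠ : ∀ bs m → length bs ≡ m → Σ (Fin m → Bool) λ c → toListᶠ c ≡ bs
fromListᶠ []       zero    _ = (λ ()) , refl
fromListᶠ (b ∷ bs) (suc m) e with fromListᶠ bs m (suc-injective e)
... | c , c≡bs = cons , cong (b ∷_) c≡bs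
  where cons : Fin (suc m) → Bool
        cons fzero    = b
        cons (fsuc i) = c i

toListᶠ≡slice : ∀ {m} (h : ℕ → Bool) o → toListᶠ {m} (λ f → h (o + toℕ f)) ≡ slice h o m
toListᶠ≡slice {zero}  h o = refl
toListᶠ≡slice {suc m} h o =
  cong₂ _∷_ (cong h (+-identityʳ o))
    (trans (toListᶠ-cong (λ i → cong h (+-suc o (toℕ i)))) (toListᶠ≡slice {m} h (suc o)))

countTrue-pick : ∀ {m} (g : Fin m → Bool) (b : Fin m) →
  countTrue (λ a → g a ∧ (toℕ a ≡ᵇ toℕ b)) ≡ (if g b then 1 else 0)
countTrue-pick {suc m} g fzero =
  trans (cong₂ _+_ (cong (λ x → if x then 1 else 0) (∧-identityʳ (g fzero))) rest) (+-identityʳ _)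
  where rest : countTrue (λ a → g (fsuc a) ∧ false) ≡ 0
        rest = trans (countTrue-cong (λ i → ∧-zeroʳ (g (fsuc i))))
                     (trans (countTrue≡ones {m} (λ _ → false))
                            (trans (cong ones (toListᶠ≡slice {m} (λ _ → false) 0)) (ones-slice-false 0 m)))
countTrue-pick {suc m} g (fsuc b) =
  trans (cong (_+ countTrue (λ a → g (fsuc a) ∧ (toℕ a ≡ᵇ toℕ b))) (cong (λ x → if x then 1 else 0) (∧-zeroʳ (g fzero))))
        (countTrue-pick (g ∘ fsuc) b)

weight-cong : ∀ {m} {u v : Vec₂ m} → u ≈ v → weight u ≡ weight v
weight-cong = countTrue-cong

weight-zeroV : ∀ {m} → weight {m} zeroV ≡ 0
weight-zeroV {zero}  = refl
weight-zeroV {suc m} = weight-zeroV {m}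

weight-chr : ∀ {m} (b : Fin m) → weight (chr b) ≡ 1
weight-chr b = countTrue-pick (λ _ → true) b

weight-⊕ : ∀ {m} (u v : Vec₂ m) → weight (u ⊕ v) ≤ weight u + weight v
weight-⊕ {zero}  u v = z≤n
weight-⊕ {suc m} u v with u fzero | v fzero | weight-⊕ (u ∘ fsuc) (v ∘ fsuc)
... | true  | true  | ih = ≤-trans ih (+-mono-≤ (n≤1+n (weight (u ∘ fsuc))) (n≤1+n (weight (v ∘ fsuc))))
... | true  | false | ih = s≤s ih
... | false | true  | ih = ≤-trans (s≤s ih) (≤-reflexive (sym (+-suc (weight (u ∘ fsuc)) (weight (v ∘ fsuc)))))
... | false | false | ih = ih

weight≡0⇒≈zeroV : ∀ {m} (u : Vec₂ m) → weight u ≡ 0 → u ≈ zeroV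
weight≡0⇒≈zeroV {suc m} u e a with u fzero in u₀
weight≡0⇒≈zeroV u () a        | true
weight≡0⇒≈zeroV u e fzero     | false = u₀
weight≡0⇒≈zeroV u e (fsuc a)  | false = weight≡0⇒≈zeroV (u ∘ fsuc) e a

weight≡1⇒≈chr : ∀ {m} (u : Vec₂ m) → weight u ≡ 1 → Σ (Fin m) λ b → u ≈ chr b
weight≡1⇒≈chr {suc m} u e with u fzero in u₀
... | true = fzero , at₀
  where at₀ : u ≈ chr fzero
        at₀ fzero    = u₀
        at₀ (fsuc a) = weight≡0⇒≈zeroV (u ∘ fsuc) (suc-injective e) a
... | false with weight≡1⇒≈chr (u ∘ fsuc) e
... | b , u≈b = fsuc b , shift
  where shift : u ≈ chr (fsuc b)
        shift fzero    = u₀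
        shift (fsuc a) = u≈b a

_≡₄_ : ℕ → ℕ → Set
x ≡₄ y = x % 4 ≡ y % 4

+-congʳ-≡₄ : ∀ x y z → x ≡₄ y → (x + z) ≡₄ (y + z)
+-congʳ-≡₄ x y z e =
  trans (%-distribˡ-+ x z 4) (trans (cong (λ w → (w + z % 4) % 4) e) (sym (%-distribˡ-+ y z 4)))

+-congˡ-≡₄ : ∀ x y z → x ≡₄ y → (z + x) ≡₄ (z + y)
+-congˡ-≡₄ x y z e = trans (cong (_% 4) (+-comm z x)) (trans (+-congʳ-≡₄ x y z e) (cong (_% 4) (+-comm y z)))

+*4-≡₄ : ∀ x a → (x + a * 4) ≡₄ x
+*4-≡₄ x a = [m+kn]%n≡m%n x a 4

+-cancelʳ-≡₄ : ∀ x y z → (x + z) ≡₄ (y + z) → x ≡₄ y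
+-cancelʳ-≡₄ x y z e = begin
  x % 4                  ≡⟨ sym (+*4-≡₄ x z) ⟩
  (x + z * 4) % 4        ≡⟨ cong (_% 4) (shift x z) ⟩
  (x + z + z * 3) % 4    ≡⟨ +-congʳ-≡₄ (x + z) (y + z) (z * 3) e ⟩
  (y + z + z * 3) % 4    ≡⟨ cong (_% 4) (sym (shift y z)) ⟩
  (y + z * 4) % 4        ≡⟨ +*4-≡₄ y z ⟩
  y % 4                  ∎
  where open ≡-Reasoning
        shift : ∀ w z → w + z * 4 ≡ w + z + z * 3
        shift = solve-∀

≡₄⇒≡ : ∀ {x y} → 1 ≤ x → x ≤ 4 → 1 ≤ y → y ≤ 4 → x ≡₄ y → x ≡ y
≡₄⇒≡ {suc x} {suc y} _ x<4 _ y<4 e = cong suc (begin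
  x        ≡⟨ sym (m<n⇒m%n≡m x<4) ⟩
  x % 4    ≡⟨ +-cancelʳ-≡₄ x y 1 (trans (cong (_% 4) (+-comm x 1)) (trans e (cong (_% 4) (+-comm 1 y)))) ⟩
  y % 4    ≡⟨ m<n⇒m%n≡m y<4 ⟩
  y        ∎)
  where open ≡-Reasoning

-- reduce₄ k is the representative of k modulo 4 in 1 … 4 (for k ≥ 1)
reduce₄ : ℕ → ℕ
reduce₄ (suc (suc (suc (suc (suc k))))) = reduce₄ (suc k)
reduce₄ k = k

reduce₄-≡₄ : ∀ k → reduce₄ k ≡₄ k
reduce₄-≡₄ (suc (suc (suc (suc (suc k))))) = reduce₄-≡₄ (suc k)
reduce₄-≡₄ 0 = refl
reduce₄-≡₄ 1 = refl
reduce₄-≡₄ 2 = refl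
reduce₄-≡₄ 3 = refl
reduce₄-≡₄ 4 = refl

reduce₄-bounds : ∀ k → 1 ≤ k → 1 ≤ reduce₄ k × reduce₄ k ≤ 4
reduce₄-bounds (suc (suc (suc (suc (suc k))))) _ = reduce₄-bounds (suc k) (s≤s z≤n)
reduce₄-bounds 1 _ = s≤s z≤n , s≤s z≤n
reduce₄-bounds 2 _ = s≤s z≤n , s≤s (s≤s z≤n)
reduce₄-bounds 3 _ = s≤s z≤n , s≤s (s≤s (s≤s z≤n))
reduce₄-bounds 4 _ = s≤s z≤n , ≤-refl

odd+odd-≡₄ : ∀ t m → parity t ≡ true → (t + t + m) ≡₄ (m + 2)
odd+odd-≡₄ t m t-odd with parity-true⇒odd t t-odd
... | a , refl = trans (cong (_% 4) (rearrange a m)) (+*4-≡₄ (m + 2) a)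
  where rearrange : ∀ a m → suc (a + a) + suc (a + a) + m ≡ m + 2 + a * 4
        rearrange = solve-∀

one-to-four : ∀ {P : ℕ → Set} → P 1 → P 2 → P 3 → P 4 → ∀ i → 1 ≤ i → i ≤ 4 → P i
one-to-four p₁ p₂ p₃ p₄ 1 _ _ = p₁
one-to-four p₁ p₂ p₃ p₄ 2 _ _ = p₂
one-to-four p₁ p₂ p₃ p₄ 3 _ _ = p₃
one-to-four p₁ p₂ p₃ p₄ 4 _ _ = p₄
one-to-four p₁ p₂ p₃ p₄ (suc (suc (suc (suc (suc _))))) _ (s≤s (s≤s (s≤s (s≤s ()))))

%4-cases : ∀ x → x % 4 ≡ 0 ⊎ x % 4 ≡ 1 ⊎ x % 4 ≡ 2 ⊎ x % 4 ≡ 3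
%4-cases 0 = inj₁ refl
%4-cases 1 = inj₂ (inj₁ refl)
%4-cases 2 = inj₂ (inj₂ (inj₁ refl))
%4-cases 3 = inj₂ (inj₂ (inj₂ refl))
%4-cases (suc (suc (suc (suc x)))) = %4-cases x

data Swaps : List Bool → List Bool → Set where
  done : ∀ {bs} → Swaps bs bs
  swap : ∀ {bs cs} i → suc (suc i) ≤ length bs → Swaps (swapAt i bs) cs → Swaps bs cs

Swaps-∷ : ∀ b {bs cs} → Swaps bs cs → Swaps (b ∷ bs) (b ∷ cs)
Swaps-∷ b done               = done
Swaps-∷ b (swap i i<bs rest) = swap (suc i) (s≤s i<bs) (Swaps-∷ b rest)

Swaps-trans : ∀ {as bs cs} → Swaps as bs → Swaps bs cs → Swaps as cs
Swaps-trans done               r = r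
Swaps-trans (swap i i<bs rest) r = swap i i<bs (Swaps-trans rest r)

Swaps-length : ∀ {bs cs} → Swaps bs cs → length cs ≡ length bs
Swaps-length done             = refl
Swaps-length (swap i _ rest)  = trans (Swaps-length rest) (length-swapAt i _)

sorted : ℕ → ℕ → List Bool
sorted k r = replicate k true ++ replicate r false

length-sorted : ∀ k r → length (sorted k r) ≡ k + r
length-sorted zero    zero    = refl
length-sorted zero    (suc r) = cong suc (length-sorted zero r)
length-sorted (suc k) r       = cong suc (length-sorted k r)

sort : ∀ bs → Σ ℕ λ r → Swaps bs (sorted (ones bs) r)
sort []           = 0 , done
sort (true ∷ bs)  with sort bs
... | r , bs↝ = r , Swaps-∷ true bs↝
sort (false ∷ bs) with sort bs
... | r , bs↝ = suc r , Swaps-trans (Swaps-∷ false bs↝) (bubble (ones bs) r)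
  where bubble : ∀ k r → Swaps (false ∷ sorted k r) (sorted k (suc r))
        bubble zero    r = done
        bubble (suc k) r = swap 0 (s≤s (s≤s z≤n)) (Swaps-∷ true (bubble k r))

slice-<ᵇ≡sorted : ∀ k r o → slice (λ j → j <ᵇ o + k) o (k + r) ≡ sorted k r
slice-<ᵇ≡sorted zero zero o = refl
slice-<ᵇ≡sorted zero (suc r) o rewrite +-identityʳ o | ≥⇒<ᵇ-false o o ≤-refl =
  cong (false ∷_) (trans (slice-cong _ _ (suc o) r above) (slice-<ᵇ≡sorted zero r (suc o)))
  where above : ∀ j → suc o ≤ j → j < suc o + r → (j <ᵇ o) ≡ (j <ᵇ suc o + 0)
        above j o<j _ = trans (≥⇒<ᵇ-false j o (<⇒≤ o<j))
                              (sym (≥⇒<ᵇ-false j (suc o + 0) (subst (_≤ j) (sym (+-identityʳ (suc o))) o<j)))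
slice-<ᵇ≡sorted (suc k) r o rewrite <⇒<ᵇ-true o (o + suc k) (subst (o <_) (sym (+-suc o k)) (s≤s (m≤m+n o k))) =
  cong (true ∷_) (trans (slice-cong _ _ (suc o) (k + r) (λ j _ _ → cong (j <ᵇ_) (+-suc o k)))
                        (slice-<ᵇ≡sorted k r (suc o)))

Σ₂ʳ : (ℕ → Bool) → ℕ → ℕ → Bool
Σ₂ʳ f o zero    = false
Σ₂ʳ f o (suc m) = f o xor Σ₂ʳ f (suc o) m

Σ₂ʳ≡Σ₂-slice : ∀ f o m → Σ₂ʳ f o m ≡ Σ₂ (slice f o m)
Σ₂ʳ≡Σ₂-slice f o zero    = refl
Σ₂ʳ≡Σ₂-slice f o (suc m) = cong (f o xor_) (Σ₂ʳ≡Σ₂-slice f (suc o) m)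

Σ₂ʳ-cong : ∀ f g o m → (∀ j → o ≤ j → j < o + m → f j ≡ g j) → Σ₂ʳ f o m ≡ Σ₂ʳ g o m
Σ₂ʳ-cong f g o m h =
  trans (Σ₂ʳ≡Σ₂-slice f o m) (trans (cong Σ₂ (slice-cong f g o m h)) (sym (Σ₂ʳ≡Σ₂-slice g o m)))

Σ₂ʳ-xor : ∀ f g o m → Σ₂ʳ (λ j → f j xor g j) o m ≡ Σ₂ʳ f o m xor Σ₂ʳ g o m
Σ₂ʳ-xor f g o zero    = refl
Σ₂ʳ-xor f g o (suc m) = trans (cong ((f o xor g o) xor_) (Σ₂ʳ-xor f g (suc o) m)) (interchange (f o) (g o) _ _)

Σ₂ʳ-false : ∀ o m → Σ₂ʳ (λ _ → false) o m ≡ false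
Σ₂ʳ-false o zero    = refl
Σ₂ʳ-false o (suc m) = Σ₂ʳ-false (suc o) m

Σ₂ʳ-pick-below : ∀ (c : ℕ → Bool) y o m → y < o → Σ₂ʳ (λ j → c j ∧ (y ≡ᵇ j)) o m ≡ false
Σ₂ʳ-pick-below c y o m y<o =
  trans (Σ₂ʳ-cong _ _ o m (λ j o≤j _ → trans (cong (c j ∧_) (≢⇒≡ᵇ-false y j (λ y≡j → <-irrefl y≡j (<-≤-trans y<o o≤j))))
                                            (∧-zeroʳ (c j))))
        (Σ₂ʳ-false o m)

Σ₂ʳ-pick : ∀ (c : ℕ → Bool) y o m → o ≤ y → y < o + m → Σ₂ʳ (λ j → c j ∧ (y ≡ᵇ j)) o m ≡ c y
Σ₂ʳ-pick c y o zero    o≤y y<o+0 = ⊥-elim (<-irrefl refl (≤-trans (subst (y <_) (+-identityʳ o) y<o+0) o≤y))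
Σ₂ʳ-pick c y o (suc m) o≤y y<o+m with y ≟ o
... | yes refl rewrite ≡ᵇ-refl y =
  trans (cong₂ _xor_ (∧-identityʳ (c y)) (Σ₂ʳ-pick-below c y (suc y) m ≤-refl)) (xor-identityʳ _)
... | no y≢o rewrite ≢⇒≡ᵇ-false y o y≢o | ∧-zeroʳ (c o) =
  Σ₂ʳ-pick c y (suc o) m (≤∧≢⇒< o≤y (y≢o ∘ sym)) (subst (y <_) (+-suc o m) y<o+m)

module _ {n : ℕ} where

  ≈-refl : {u : Vec₂ n} → u ≈ u
  ≈-refl _ = refl

  ≈-sym : {u v : Vec₂ n} → u ≈ v → v ≈ u
  ≈-sym u≈v a = sym (u≈v a)

  ≈-trans : {u v w : Vec₂ n} → u ≈ v → v ≈ w → u ≈ w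
  ≈-trans u≈v v≈w a = trans (u≈v a) (v≈w a)

  ≡⇒≈ : {u v : Vec₂ n} → u ≡ v → u ≈ v
  ≡⇒≈ refl = ≈-refl

  ⊕-cong : {u u′ v v′ : Vec₂ n} → u ≈ u′ → v ≈ v′ → (u ⊕ v) ≈ (u′ ⊕ v′)
  ⊕-cong h h′ a = cong₂ _xor_ (h a) (h′ a)

  ⊕-leftComm : (u v w : Vec₂ n) → (u ⊕ (v ⊕ w)) ≈ (v ⊕ (u ⊕ w))
  ⊕-leftComm u v w a = xor-leftComm (u a) (v a) (w a)

  _·_ : Bool → Vec₂ n → Vec₂ n
  b · v = if b then v else zeroV

  ·-coord : ∀ b v a → (b · v) a ≡ b ∧ v a
  ·-coord true  v a = refl
  ·-coord false v a = refl

  ·-cong : ∀ b {u v} → u ≈ v → (b · u) ≈ (b · v)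
  ·-cong true  u≈v = u≈v
  ·-cong false _   = ≈-refl

  xor-· : ∀ a b v → ((a xor b) · v) ≈ ((a · v) ⊕ (b · v))
  xor-· true  true  v x = sym (xor-same (v x))
  xor-· true  false v x = sym (xor-identityʳ (v x))
  xor-· false b     v x = refl

  lincomb : List Bool → (ℕ → Vec₂ n) → ℕ → Vec₂ n
  lincomb []       X o = zeroV
  lincomb (b ∷ bs) X o = (b · X o) ⊕ lincomb bs X (suc o)

  lincomb-cong : ∀ bs {X Y} o → (∀ j → o ≤ j → X j ≈ Y j) → lincomb bs X o ≈ lincomb bs Y o
  lincomb-cong []       o h = ≈-refl
  lincomb-cong (b ∷ bs) o h = ⊕-cong (·-cong b (h o ≤-refl)) (lincomb-cong bs (suc o) (λ j o<j → h j (<⇒≤ o<j)))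

  lincomb-xorᴸ : ∀ bs cs X o → length bs ≡ length cs →
    lincomb (xorᴸ bs cs) X o ≈ (lincomb bs X o ⊕ lincomb cs X o)
  lincomb-xorᴸ []       []       X o _ _ = refl
  lincomb-xorᴸ (b ∷ bs) (c ∷ cs) X o e x =
    trans (cong₂ _xor_ (xor-· b c (X o) x) (lincomb-xorᴸ bs cs X (suc o) (suc-injective e) x))
          (interchange ((b · X o) x) ((c · X o) x) _ _)

  lincomb-ones≡0 : ∀ bs X o → ones bs ≡ 0 → lincomb bs X o ≈ zeroV
  lincomb-ones≡0 []           X o _ = ≈-refl
  lincomb-ones≡0 (false ∷ bs) X o e = lincomb-ones≡0 bs X (suc o) e

  lincomb-coord : ∀ bs X o a → lincomb bs X o a ≡ Σ₂ (andᴸ bs (slice (λ j → X j a) o (length bs)))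
  lincomb-coord []       X o a = refl
  lincomb-coord (b ∷ bs) X o a = cong₂ _xor_ (·-coord b (X o) a) (lincomb-coord bs X (suc o) a)

  lincomb-slice-coord : ∀ c X m a → lincomb (slice c 0 m) X 0 a ≡ Σ₂ʳ (λ j → c j ∧ X j a) 0 m
  lincomb-slice-coord c X m a = trans (lincomb-coord (slice c 0 m) X 0 a)
    (trans (cong (λ k → Σ₂ (andᴸ (slice c 0 m) (slice (λ j → X j a) 0 k))) (length-slice c 0 m))
           (trans (cong Σ₂ (andᴸ-slice 0 m)) (sym (Σ₂ʳ≡Σ₂-slice _ 0 m))))
    where andᴸ-slice : ∀ o k → andᴸ (slice c o k) (slice (λ j → X j a) o k) ≡ slice (λ j → c j ∧ X j a) o k
          andᴸ-slice o zero    = refl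
          andᴸ-slice o (suc k) = cong (c o ∧ X o a ∷_) (andᴸ-slice (suc o) k)

transpose : ℕ → ℕ → ℕ
transpose i j = if j ≡ᵇ i then suc i else (if j ≡ᵇ suc i then i else j)

transpose-≡ : ∀ i → transpose i i ≡ suc i
transpose-≡ i rewrite ≡ᵇ-refl i = refl

transpose-suc : ∀ i → transpose i (suc i) ≡ i
transpose-suc i rewrite ≢⇒≡ᵇ-false (suc i) i (λ e → <-irrefl (sym e) ≤-refl) | ≡ᵇ-refl i = refl

transpose-≢ : ∀ i j → j ≢ i → j ≢ suc i → transpose i j ≡ j
transpose-≢ i j j≢i j≢1+i rewrite ≢⇒≡ᵇ-false j i j≢i | ≢⇒≡ᵇ-false j (suc i) j≢1+i = refl

lincomb-swapAt : ∀ {n} d o bs (X : ℕ → Vec₂ n) → suc (suc d) ≤ length bs →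
  lincomb bs (X ∘ transpose (o + d)) o ≈ lincomb (swapAt d bs) X o
lincomb-swapAt zero o (b₀ ∷ b₁ ∷ r) X _ rewrite +-identityʳ o =
  ≈-trans (⊕-cong (·-cong b₀ (≡⇒≈ (cong X (transpose-≡ o))))
            (⊕-cong (·-cong b₁ (≡⇒≈ (cong X (transpose-suc o)))) (lincomb-cong r (suc (suc o)) fixed)))
          (⊕-leftComm (b₀ · X (suc o)) (b₁ · X o) (lincomb r X (suc (suc o))))
  where fixed : ∀ j → suc (suc o) ≤ j → X (transpose o j) ≈ X j
        fixed j 2+o≤j = ≡⇒≈ (cong X (transpose-≢ o j (λ e → <-irrefl (sym e) (<⇒≤ 2+o≤j)) (λ e → <-irrefl (sym e) 2+o≤j)))
lincomb-swapAt zero o (b ∷ []) X (s≤s ())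
lincomb-swapAt (suc d) o (b ∷ r) X (s≤s 2+d≤r) =
  ⊕-cong (·-cong b (≡⇒≈ (cong X (transpose-≢ (o + suc d) o (λ e → <-irrefl e (m<m+n o (s≤s z≤n)))
                                                            (λ e → <-irrefl e (s≤s (m≤m+n o (suc d))))))))
         (≈-trans (lincomb-cong r (suc o) (λ j _ → ≡⇒≈ (cong (λ k → X (transpose k j)) (+-suc o d))))
                  (lincomb-swapAt d (suc o) r X 2+d≤r))

module _ {n : ℕ} (S : Graph n) where

  flip-cong : ∀ s {u v : Vec₂ n} → u ≈ v → flip S s u ≈ flip S s v
  flip-cong s u≈v a = cong₂ (λ x y → x xor (adj S a s ∧ y)) (u≈v a) (u≈v s)

  flip-⊕ : ∀ s (u v : Vec₂ n) → flip S s (u ⊕ v) ≈ (flip S s u ⊕ flip S s v)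
  flip-⊕ s u v a = trans (cong ((u a xor v a) xor_) (∧-distribˡ-xor (adj S a s) (u s) (v s)))
                         (interchange (u a) (v a) (adj S a s ∧ u s) (adj S a s ∧ v s))

  flip-zeroV : ∀ s → flip S s zeroV ≈ zeroV
  flip-zeroV s a = cong (false xor_) (∧-zeroʳ (adj S a s))

  flip-fix : ∀ s (v : Vec₂ n) → v s ≡ false → flip S s v ≈ v
  flip-fix s v vₛ≡0 a rewrite vₛ≡0 | ∧-zeroʳ (adj S a s) = xor-identityʳ (v a)

  flip-self : ∀ s (v : Vec₂ n) → flip S s v s ≡ v s
  flip-self s v rewrite irrefl S s = xor-identityʳ (v s)

  flip-involutive : ∀ s (v : Vec₂ n) → flip S s (flip S s v) ≈ v
  flip-involutive s v a rewrite flip-self s v =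
    trans (xor-assoc (v a) (adj S a s ∧ v s) (adj S a s ∧ v s))
          (trans (cong (v a xor_) (xor-same (adj S a s ∧ v s))) (xor-identityʳ (v a)))

  flip-· : ∀ s b v → flip S s (b · v) ≈ (b · flip S s v)
  flip-· s true  v = ≈-refl
  flip-· s false v = flip-zeroV s

  flip-lincomb : ∀ s bs X o → flip S s (lincomb bs X o) ≈ lincomb bs (λ j → flip S s (X j)) o
  flip-lincomb s []       X o = flip-zeroV s
  flip-lincomb s (b ∷ bs) X o =
    ≈-trans (flip-⊕ s (b · X o) (lincomb bs X (suc o))) (⊕-cong (flip-· s b (X o)) (flip-lincomb s bs X (suc o)))

  applyWord-cong : ∀ ws {u v : Vec₂ n} → u ≈ v → applyWord S ws u ≈ applyWord S ws v
  applyWord-cong []       u≈v = u≈v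
  applyWord-cong (s ∷ ws) u≈v = flip-cong s (applyWord-cong ws u≈v)

  applyWord-zeroV : ∀ ws → applyWord S ws zeroV ≈ zeroV
  applyWord-zeroV []       = ≈-refl
  applyWord-zeroV (s ∷ ws) = ≈-trans (flip-cong s (applyWord-zeroV ws)) (flip-zeroV s)

  applyWord-++ : ∀ ws vs (u : Vec₂ n) → applyWord S (ws ++ vs) u ≡ applyWord S ws (applyWord S vs u)
  applyWord-++ ws vs u = foldr-++ (flip S) u ws vs

  applyWord-reverse : ∀ ws (u : Vec₂ n) → applyWord S (reverse ws) (applyWord S ws u) ≈ u
  applyWord-reverse []       u   = ≈-refl
  applyWord-reverse (s ∷ ws) u a = begin
    applyWord S (reverse (s ∷ ws)) (flip S s (applyWord S ws u)) a
      ≡⟨ cong (λ w → applyWord S w (flip S s (applyWord S ws u)) a) (unfold-reverse s ws) ⟩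
    applyWord S (reverse ws ++ [ s ]) (flip S s (applyWord S ws u)) a
      ≡⟨ cong (_$ a) (applyWord-++ (reverse ws) [ s ] _) ⟩
    applyWord S (reverse ws) (flip S s (flip S s (applyWord S ws u))) a
      ≡⟨ applyWord-cong (reverse ws) (flip-involutive s (applyWord S ws u)) a ⟩
    applyWord S (reverse ws) (applyWord S ws u) a
      ≡⟨ applyWord-reverse ws u a ⟩
    u a ∎
    where open ≡-Reasoning

  Reach-≈ : {u v : Vec₂ n} → u ≈ v → Reach S u v
  Reach-≈ u≈v = [] , u≈v

  Reach-flip : ∀ s {u v : Vec₂ n} → flip S s u ≈ v → Reach S u v
  Reach-flip s h = [ s ] , h

  Reach-trans : {u v w : Vec₂ n} → Reach S u v → Reach S v w → Reach S u w
  Reach-trans {u} (ws , h) (vs , h′) =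
    vs ++ ws , λ a → trans (cong (_$ a) (applyWord-++ vs ws u)) (trans (applyWord-cong vs h a) (h′ a))

  Reach-sym : {u v : Vec₂ n} → Reach S u v → Reach S v u
  Reach-sym {u} (ws , h) = reverse ws , ≈-trans (applyWord-cong (reverse ws) (≈-sym h)) (applyWord-reverse ws u)

  Reach-zeroV : {u v : Vec₂ n} → Reach S u v → v ≈ zeroV → u ≈ zeroV
  Reach-zeroV r v≈0 with Reach-sym r
  ... | ws , h = ≈-trans (≈-sym h) (≈-trans (applyWord-cong ws v≈0) (applyWord-zeroV ws))

-- On the path s₁ … sₙ₋₁ (indices 0 … n-2) the vector \overline{k+1} is s̃ₖ + s̃ₖ₊₁ (with s̃₀ = 0);
-- this is the inductive step of that computation.
path-step : ∀ x k → ((x ≡ᵇ k) xor (suc x ≡ᵇ k)) xor (((suc x ≡ᵇ k) ∨ (suc k ≡ᵇ x)) ∧ true)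
                   ≡ (x ≡ᵇ suc k) xor (suc x ≡ᵇ suc k)
path-step zero    zero    = refl
path-step zero    (suc k) with zero ≡ᵇ k
... | true  = refl
... | false = refl
path-step (suc x) zero    with x
... | zero  = refl
... | suc _ = refl
path-step (suc x) (suc k) = path-step x k

module Basis {n : ℕ} (S : Graph n) (n≥2 : 2 ≤ n) (path : InducedPathPrefix S) where

  n∸1<n : n ∸ 1 < n
  n∸1<n = pred< n n≥2
    where pred< : ∀ m → 2 ≤ m → m ∸ 1 < m
          pred< (suc (suc k)) _ = ≤-refl
          pred< (suc zero) (s≤s ())

  sₙ : Fin n
  sₙ = fromℕ< n∸1<n

  toℕ-sₙ : toℕ sₙ ≡ n ∸ 1
  toℕ-sₙ = toℕ-fromℕ< n∸1<n

  path-or-sₙ : ∀ (a : Fin n) → suc (toℕ a) < n ⊎ a ≡ sₙ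
  path-or-sₙ a with suc (toℕ a) <? n
  ... | yes a<n∸1 = inj₁ a<n∸1
  ... | no  a≮n∸1 = inj₂ (toℕ-injective (trans (cong (_∸ 1) (≤-antisym (toℕ<n a) (≮⇒≥ a≮n∸1))) (sym toℕ-sₙ)))

  lower : ∀ {k} → suc k < n → k < n
  lower = ≤-trans (n≤1+n _)

  vertex : ∀ {k} → suc k < n → Fin n
  vertex k+1<n = fromℕ< (lower k+1<n)

  toℕ-vertex : ∀ {k} (k+1<n : suc k < n) → toℕ (vertex k+1<n) ≡ k
  toℕ-vertex k+1<n = toℕ-fromℕ< (lower k+1<n)

  piN-path-coord : ∀ k (k<n : k < n) (a : Fin n) → suc (toℕ a) < n →
    piN S k k<n a ≡ (toℕ a ≡ᵇ k) xor (suc (toℕ a) ≡ᵇ k)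
  piN-path-coord zero    k<n a _     = trans (cong (toℕ a ≡ᵇ_) (toℕ-fromℕ< k<n)) (sym (xor-identityʳ _))
  piN-path-coord (suc k) k<n a a<n∸1 = begin
    piN S k k<n′ a xor (adj S a v ∧ piN S k k<n′ v)
      ≡⟨ cong₂ (λ x y → x xor (y ∧ piN S k k<n′ v)) (piN-path-coord k k<n′ a a<n∸1) adj-a-v ⟩
    ((toℕ a ≡ᵇ k) xor (suc (toℕ a) ≡ᵇ k)) xor (((suc (toℕ a) ≡ᵇ k) ∨ (suc k ≡ᵇ toℕ a)) ∧ piN S k k<n′ v)
      ≡⟨ cong (λ y → ((toℕ a ≡ᵇ k) xor (suc (toℕ a) ≡ᵇ k)) xor (((suc (toℕ a) ≡ᵇ k) ∨ (suc k ≡ᵇ toℕ a)) ∧ y)) v-on ⟩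
    ((toℕ a ≡ᵇ k) xor (suc (toℕ a) ≡ᵇ k)) xor (((suc (toℕ a) ≡ᵇ k) ∨ (suc k ≡ᵇ toℕ a)) ∧ true)
      ≡⟨ path-step (toℕ a) k ⟩
    (toℕ a ≡ᵇ suc k) xor (suc (toℕ a) ≡ᵇ suc k) ∎
    where
    open ≡-Reasoning
    k<n′ : k < n
    k<n′ = lower k<n
    v : Fin n
    v = fromℕ< k<n′
    toℕ-v : toℕ v ≡ k
    toℕ-v = toℕ-fromℕ< k<n′
    v<n∸1 : suc (toℕ v) < n
    v<n∸1 = subst (λ z → suc z < n) (sym toℕ-v) k<n
    adj-a-v : adj S a v ≡ ((suc (toℕ a) ≡ᵇ k) ∨ (suc k ≡ᵇ toℕ a))
    adj-a-v = trans (path a v a<n∸1 v<n∸1) (cong (λ z → (suc (toℕ a) ≡ᵇ z) ∨ (suc z ≡ᵇ toℕ a)) toℕ-v)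
    v-on : piN S k k<n′ v ≡ true
    v-on = trans (piN-path-coord k k<n′ v v<n∸1)
      (trans (cong (λ z → (z ≡ᵇ k) xor (suc z ≡ᵇ k)) toℕ-v)
             (cong₂ _xor_ (≡ᵇ-refl k) (≢⇒≡ᵇ-false (suc k) k (λ e → <-irrefl (sym e) ≤-refl))))

  π : ℕ → Vec₂ n
  π k with k <? n
  ... | yes k<n = piN S k k<n
  ... | no  _   = zeroV

  π-piN : ∀ k (k<n : k < n) → π k ≡ piN S k k<n
  π-piN k k<n with k <? n
  ... | yes k<n′ = cong (piN S k) (<-irrelevant k<n′ k<n)
  ... | no  k≮n  = ⊥-elim (k≮n k<n)

  π-path-coord : ∀ k (a : Fin n) → suc (toℕ a) < n → π k a ≡ (toℕ a ≡ᵇ k) xor (suc (toℕ a) ≡ᵇ k)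
  π-path-coord k a a<n∸1 with k <? n
  ... | yes k<n = piN-path-coord k k<n a a<n∸1
  ... | no  k≮n = sym (cong₂ _xor_ (≢⇒≡ᵇ-false (toℕ a) k (λ e → k≮n (subst (_< n) e (<⇒≤ a<n∸1))))
                                   (≢⇒≡ᵇ-false (suc (toℕ a)) k (λ e → k≮n (subst (_< n) e a<n∸1))))

  π-vertex : ∀ {k} (k+1<n : suc k < n) → π k (vertex k+1<n) ≡ true
  π-vertex {k} k+1<n = trans (π-path-coord k (vertex k+1<n) (subst (λ z → suc z < n) (sym (toℕ-vertex k+1<n)) k+1<n))
    (trans (cong (λ z → (z ≡ᵇ k) xor (suc z ≡ᵇ k)) (toℕ-vertex k+1<n))
           (cong₂ _xor_ (≡ᵇ-refl k) (≢⇒≡ᵇ-false (suc k) k (λ e → <-irrefl (sym e) ≤-refl))))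

  -- γ k records whether \overline{k+1} ∈ Π₁
  γ : ℕ → Bool
  γ k = π k sₙ

  γ-suc : ∀ k (k+1<n : suc k < n) → γ (suc k) ≡ γ k xor adj S sₙ (vertex k+1<n)
  γ-suc k k+1<n rewrite π-piN (suc k) k+1<n | π-piN k (lower k+1<n) =
    cong (piN S k (lower k+1<n) sₙ xor_)
         (trans (cong (adj S sₙ (vertex k+1<n) ∧_) (trans (cong (_$ vertex k+1<n) (sym (π-piN k (lower k+1<n)))) (π-vertex k+1<n)))
                (∧-identityʳ _))

  flip-π : ∀ i (i+1<n : suc i < n) j → flip S (vertex i+1<n) (π j) ≈ π (transpose i j)
  flip-π i i+1<n j with j ≡ᵇ i in j≡i
  ... | true  rewrite ≡ᵇ-true⇒≡ j i j≡i | π-piN (suc i) i+1<n | π-piN i (lower i+1<n) = ≈-refl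
  ... | false with j ≡ᵇ suc i in j≡1+i
  ... | true  rewrite ≡ᵇ-true⇒≡ j (suc i) j≡1+i | π-piN (suc i) i+1<n | π-piN i (lower i+1<n) =
    flip-involutive S _ _
  ... | false = flip-fix S _ (π j) (trans (π-path-coord j v v<n∸1)
                  (trans (cong (λ z → (z ≡ᵇ j) xor (suc z ≡ᵇ j)) (toℕ-vertex i+1<n))
                         (cong₂ _xor_ (trans (≡ᵇ-sym i j) j≡i) (trans (≡ᵇ-sym (suc i) j) j≡1+i))))
    where v : Fin n
          v = vertex i+1<n
          v<n∸1 : suc (toℕ v) < n
          v<n∸1 = subst (λ z → suc z < n) (sym (toℕ-vertex i+1<n)) i+1<n

  -- ⟦ bs ⟧ is the vector with coordinates bs in Π, and ⟦ c ⟧ᶠ the one with coordinates c 0 … c (n-1)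
  ⟦_⟧ : List Bool → Vec₂ n
  ⟦ bs ⟧ = lincomb bs π 0

  ⟦_⟧ᶠ : (ℕ → Bool) → Vec₂ n
  ⟦ c ⟧ᶠ = ⟦ slice c 0 n ⟧

  flip-swapAt : ∀ i (i+1<n : suc i < n) bs → suc (suc i) ≤ length bs →
    flip S (vertex i+1<n) ⟦ bs ⟧ ≈ ⟦ swapAt i bs ⟧
  flip-swapAt i i+1<n bs 2+i≤bs =
    ≈-trans (flip-lincomb S (vertex i+1<n) bs π 0)
            (≈-trans (lincomb-cong bs 0 (λ j _ → flip-π i i+1<n j)) (lincomb-swapAt i 0 bs π 2+i≤bs))

  ⟦⟧ᶠ-path-coord : ∀ c (a : Fin n) → suc (toℕ a) < n → ⟦ c ⟧ᶠ a ≡ c (toℕ a) xor c (suc (toℕ a))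
  ⟦⟧ᶠ-path-coord c a a<n∸1 = begin
    ⟦ c ⟧ᶠ a
      ≡⟨ lincomb-slice-coord c π n a ⟩
    Σ₂ʳ (λ j → c j ∧ π j a) 0 n
      ≡⟨ Σ₂ʳ-cong _ _ 0 n (λ j _ _ → cong (c j ∧_) (π-path-coord j a a<n∸1)) ⟩
    Σ₂ʳ (λ j → c j ∧ ((toℕ a ≡ᵇ j) xor (suc (toℕ a) ≡ᵇ j))) 0 n
      ≡⟨ Σ₂ʳ-cong _ _ 0 n (λ j _ _ → ∧-distribˡ-xor (c j) _ _) ⟩
    Σ₂ʳ (λ j → (c j ∧ (toℕ a ≡ᵇ j)) xor (c j ∧ (suc (toℕ a) ≡ᵇ j))) 0 n
      ≡⟨ Σ₂ʳ-xor _ _ 0 n ⟩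
    Σ₂ʳ (λ j → c j ∧ (toℕ a ≡ᵇ j)) 0 n xor Σ₂ʳ (λ j → c j ∧ (suc (toℕ a) ≡ᵇ j)) 0 n
      ≡⟨ cong₂ _xor_ (Σ₂ʳ-pick c (toℕ a) 0 n z≤n (<⇒≤ a<n∸1)) (Σ₂ʳ-pick c (suc (toℕ a)) 0 n z≤n a<n∸1) ⟩
    c (toℕ a) xor c (suc (toℕ a)) ∎
    where open ≡-Reasoning

  ⟦⟧ᶠ-sₙ-coord : ∀ c → ⟦ c ⟧ᶠ sₙ ≡ Σ₂ʳ (λ j → c j ∧ γ j) 0 n
  ⟦⟧ᶠ-sₙ-coord c = lincomb-slice-coord c π n sₙ

  Γ Γᶜ : List Bool
  Γ  = slice γ 0 n
  Γᶜ = slice (not ∘ γ) 0 n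

  p q : ℕ
  p = ones Γ
  q = ones Γᶜ

  q+p≡n : q + p ≡ n
  q+p≡n = trans (cong (λ z → ones z + p) (sym (map-not-slice γ 0 n))) (trans (ones-map-not Γ) (length-slice γ 0 n))

  ⟦Γᶜ⟧≈adj-sₙ : ⟦ not ∘ γ ⟧ᶠ ≈ (λ a → adj S a sₙ)
  ⟦Γᶜ⟧≈adj-sₙ a with path-or-sₙ a
  ... | inj₁ a<n∸1 = begin
    ⟦ not ∘ γ ⟧ᶠ a                                   ≡⟨ ⟦⟧ᶠ-path-coord (not ∘ γ) a a<n∸1 ⟩
    not (γ (toℕ a)) xor not (γ (suc (toℕ a)))        ≡⟨ xor-annihilates-not (γ (toℕ a)) _ ⟩
    γ (toℕ a) xor γ (suc (toℕ a))                    ≡⟨ cong (γ (toℕ a) xor_) (γ-suc (toℕ a) a<n∸1) ⟩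
    γ (toℕ a) xor (γ (toℕ a) xor adj S sₙ (vertex a<n∸1))  ≡⟨ xor-cancelˡ (γ (toℕ a)) _ ⟩
    adj S sₙ (vertex a<n∸1)                          ≡⟨ cong (adj S sₙ) (fromℕ<-toℕ a _) ⟩
    adj S sₙ a                                       ≡⟨ Graph.sym S sₙ a ⟩
    adj S a sₙ                                       ∎
    where open ≡-Reasoning
  ... | inj₂ refl = trans (⟦⟧ᶠ-sₙ-coord (not ∘ γ))
    (trans (Σ₂ʳ-cong _ _ 0 n (λ j _ _ → not-∧-self (γ j))) (trans (Σ₂ʳ-false 0 n) (sym (irrefl S sₙ))))
    where not-∧-self : ∀ x → not x ∧ x ≡ false
          not-∧-self true  = refl
          not-∧-self false = refl

  ⟦⟧-sₙ-coord : ∀ bs → length bs ≡ n → ⟦ bs ⟧ sₙ ≡ parity (ones (andᴸ bs Γ))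
  ⟦⟧-sₙ-coord bs bs≡n = trans (lincomb-coord bs π 0 sₙ)
    (trans (cong (λ m → Σ₂ (andᴸ bs (slice γ 0 m))) bs≡n) (Σ₂≡parity-ones (andᴸ bs Γ)))

  flip-sₙ-lit : ∀ bs → length bs ≡ n → ⟦ bs ⟧ sₙ ≡ true → flip S sₙ ⟦ bs ⟧ ≈ ⟦ xorᴸ bs Γᶜ ⟧
  flip-sₙ-lit bs bs≡n lit a = begin
    ⟦ bs ⟧ a xor (adj S a sₙ ∧ ⟦ bs ⟧ sₙ)   ≡⟨ cong (λ z → ⟦ bs ⟧ a xor (adj S a sₙ ∧ z)) lit ⟩
    ⟦ bs ⟧ a xor (adj S a sₙ ∧ true)        ≡⟨ cong (⟦ bs ⟧ a xor_) (trans (∧-identityʳ _) (sym (⟦Γᶜ⟧≈adj-sₙ a))) ⟩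
    ⟦ bs ⟧ a xor ⟦ Γᶜ ⟧ a                    ≡⟨ sym (lincomb-xorᴸ bs Γᶜ π 0 (trans bs≡n (sym (length-slice _ 0 n))) a) ⟩
    ⟦ xorᴸ bs Γᶜ ⟧ a                         ∎
    where open ≡-Reasoning

  dot-chrLast : ∀ (u : Vec₂ n) → dot u chrLast ≡ u sₙ
  dot-chrLast u = trans (cong parity (trans (countTrue-cong (λ a → cong (λ z → u a ∧ (toℕ a ≡ᵇ z)) (sym toℕ-sₙ)))
                                            (countTrue-pick u sₙ)))
                        (parity-indicator (u sₙ))
    where parity-indicator : ∀ x → parity (if x then 1 else 0) ≡ x
          parity-indicator true  = refl
          parity-indicator false = refl

  inΠ₁≡γ : ∀ f → inΠ₁ S f ≡ γ (toℕ f)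
  inΠ₁≡γ f = trans (dot-chrLast (pi S f)) (cong (_$ sₙ) (sym (π-piN (toℕ f) (toℕ<n f))))

  cntΠ₁≡ones : ∀ m → cntΠ₁ S m ≡ ones (slice (λ j → (j <ᵇ m) ∧ γ j) 0 n)
  cntΠ₁≡ones m = trans (countTrue-cong (λ f → cong ((toℕ f <ᵇ m) ∧_) (inΠ₁≡γ f)))
    (trans (countTrue≡ones {n} (λ f → (toℕ f <ᵇ m) ∧ γ (toℕ f)))
           (cong ones (toListᶠ≡slice {n} (λ j → (j <ᵇ m) ∧ γ j) 0)))

  sizeΠ₁≡p : sizeΠ₁ S ≡ p
  sizeΠ₁≡p = trans (cntΠ₁≡ones n) (cong ones (slice-cong _ _ 0 n (λ j _ j<n → cong (_∧ γ j) (<⇒<ᵇ-true j n j<n))))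

  Swaps-Reach : ∀ {bs cs} → Swaps bs cs → length bs ≡ n → Reach S ⟦ bs ⟧ ⟦ cs ⟧
  Swaps-Reach done                    _     = Reach-≈ S ≈-refl
  Swaps-Reach {bs} (swap i 2+i≤bs rest) bs≡n =
    Reach-trans S (Reach-flip S (vertex i+1<n) (flip-swapAt i i+1<n bs 2+i≤bs))
                  (Swaps-Reach rest (trans (length-swapAt i bs) bs≡n))
    where i+1<n : suc i < n
          i+1<n = subst (suc (suc i) ≤_) bs≡n 2+i≤bs

  -- prefix k = \overline{1} + ⋯ + \overline{k}
  prefix : ℕ → Vec₂ n
  prefix k = ⟦ _<ᵇ k ⟧ᶠ

  Reach-prefix : ∀ bs → length bs ≡ n → Reach S ⟦ bs ⟧ (prefix (ones bs))
  Reach-prefix bs bs≡n with sort bs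
  ... | r , bs↝ = Reach-trans S (Swaps-Reach bs↝ bs≡n) (Reach-≈ S (≡⇒≈ (cong ⟦_⟧ sorted≡slice)))
    where k+r≡n : ones bs + r ≡ n
          k+r≡n = trans (sym (length-sorted (ones bs) r)) (trans (Swaps-length bs↝) bs≡n)
          sorted≡slice : sorted (ones bs) r ≡ slice (_<ᵇ ones bs) 0 n
          sorted≡slice = trans (sym (slice-<ᵇ≡sorted (ones bs) r 0)) (cong (slice (_<ᵇ ones bs) 0) k+r≡n)

  sumSel≈lincomb : ∀ {m} (c : Fin m → Bool) (x : Fin m → Vec₂ n) o → (∀ j → x j ≈ π (o + toℕ j)) →
    sumSel c x ≈ lincomb (toListᶠ c) π o
  sumSel≈lincomb {zero}  c x o h = ≈-refl
  sumSel≈lincomb {suc m} c x o h =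
    ⊕-cong (·-cong (c fzero) (≈-trans (h fzero) (≡⇒≈ (cong π (+-identityʳ o)))))
           (sumSel≈lincomb (c ∘ fsuc) (x ∘ fsuc) (suc o) (λ j → ≈-trans (h (fsuc j)) (≡⇒≈ (cong π (+-suc o (toℕ j))))))

  sumSel-pi≈⟦⟧ : ∀ (c : Fin n → Bool) → sumSel c (pi S) ≈ ⟦ toListᶠ c ⟧
  sumSel-pi≈⟦⟧ c = sumSel≈lincomb c (pi S) 0 (λ j → ≡⇒≈ (sym (π-piN (toℕ j) (toℕ<n j))))

  InU→⟦⟧ : ∀ {T : ℕ → Set} {v} → InU S T v → Σ (List Bool) λ bs → length bs ≡ n × ⟦ bs ⟧ ≈ v × T (ones bs)
  InU→⟦⟧ {T} (c , c≈v , Tc) =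
    toListᶠ c , length-toListᶠ c , ≈-trans (≈-sym (sumSel-pi≈⟦⟧ c)) c≈v , subst T (countTrue≡ones c) Tc

  ⟦⟧→InU : ∀ {T : ℕ → Set} {v} bs → length bs ≡ n → ⟦ bs ⟧ ≈ v → T (ones bs) → InU S T v
  ⟦⟧→InU {T} bs bs≡n bs≈v Tbs with fromListᶠ bs n bs≡n
  ... | c , c≡bs = c , ≈-trans (sumSel-pi≈⟦⟧ c) (≈-trans (≡⇒≈ (cong ⟦_⟧ c≡bs)) bs≈v)
                     , subst T (sym (trans (countTrue≡ones c) (cong ones c≡bs))) Tbs

  ⟦⟧ᶠ≈ : ∀ c (u : Vec₂ n) → (∀ a → suc (toℕ a) < n → c (toℕ a) xor c (suc (toℕ a)) ≡ u a) →
    Σ₂ʳ (λ j → c j ∧ γ j) 0 n ≡ u sₙ → ⟦ c ⟧ᶠ ≈ u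
  ⟦⟧ᶠ≈ c u on-path on-sₙ a with path-or-sₙ a
  ... | inj₁ a<n∸1 = trans (⟦⟧ᶠ-path-coord c a a<n∸1) (on-path a a<n∸1)
  ... | inj₂ refl  = trans (⟦⟧ᶠ-sₙ-coord c) on-sₙ

  chr-sₙ-path : ∀ (a : Fin n) → suc (toℕ a) < n → chr sₙ a ≡ false
  chr-sₙ-path a a<n∸1 = ≢⇒≡ᵇ-false (toℕ a) (toℕ sₙ) (λ a≡sₙ → <-irrefl (sym (begin
    n                 ≡⟨ sym (m∸n+n≡m (≤-trans (s≤s z≤n) n≥2)) ⟩
    n ∸ 1 + 1         ≡⟨ +-comm (n ∸ 1) 1 ⟩
    suc (n ∸ 1)       ≡⟨ cong suc (sym (trans a≡sₙ toℕ-sₙ)) ⟩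
    suc (toℕ a)       ∎)) a<n∸1)
    where open ≡-Reasoning

  chr-vertex : ∀ {m} (m+1<n : suc m < n) (a : Fin n) → chr (vertex m+1<n) a ≡ (toℕ a ≡ᵇ m)
  chr-vertex m+1<n a = cong (toℕ a ≡ᵇ_) (toℕ-vertex m+1<n)

  chr-vertex-sₙ : ∀ {m} (m+1<n : suc m < n) → chr (vertex m+1<n) sₙ ≡ false
  chr-vertex-sₙ {m} m+1<n = trans (chr-vertex m+1<n sₙ)
    (≢⇒≡ᵇ-false (toℕ sₙ) m (λ sₙ≡m → <-irrefl (sym (trans (sym toℕ-sₙ) sₙ≡m)) (∸-monoˡ-≤ 1 m+1<n)))

  chr⊕sₙ : ∀ {m} → suc m < n → Bool → Vec₂ n
  chr⊕sₙ m+1<n b = chr (vertex m+1<n) ⊕ (b · chr sₙ)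

  chr⊕sₙ-path : ∀ {m} (m+1<n : suc m < n) b (a : Fin n) → suc (toℕ a) < n → chr⊕sₙ m+1<n b a ≡ (toℕ a ≡ᵇ m)
  chr⊕sₙ-path m+1<n b a a<n∸1 =
    trans (cong₂ _xor_ (chr-vertex m+1<n a) (trans (·-coord b (chr sₙ) a) (trans (cong (b ∧_) (chr-sₙ-path a a<n∸1)) (∧-zeroʳ b))))
          (xor-identityʳ _)

  chr⊕sₙ-sₙ : ∀ {m} (m+1<n : suc m < n) b → chr⊕sₙ m+1<n b sₙ ≡ b
  chr⊕sₙ-sₙ m+1<n b =
    cong₂ _xor_ (chr-vertex-sₙ m+1<n) (trans (·-coord b (chr sₙ) sₙ) (trans (cong (b ∧_) (≡ᵇ-refl (toℕ sₙ))) (∧-identityʳ b)))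

  weight-chr⊕sₙ : ∀ {m} (m+1<n : suc m < n) b → weight (chr⊕sₙ m+1<n b) ≤ 2
  weight-chr⊕sₙ m+1<n b = ≤-trans (weight-⊕ (chr (vertex m+1<n)) (b · chr sₙ))
    (subst (_≤ 2) (cong (_+ weight (b · chr sₙ)) (sym (weight-chr (vertex m+1<n)))) (s≤s (weight-· b)))
    where weight-· : ∀ b → weight (b · chr sₙ) ≤ 1
          weight-· true  = ≤-reflexive (weight-chr sₙ)
          weight-· false = ≤-trans (≤-reflexive (weight-zeroV {n})) z≤n

  β : ℕ → Bool
  β m = Σ₂ʳ (λ j → (j <ᵇ m) ∧ γ j) 0 n

  β≡parity-cntΠ₁ : ∀ m → β m ≡ parity (cntΠ₁ S m)
  β≡parity-cntΠ₁ m = trans (Σ₂ʳ≡Σ₂-slice _ 0 n)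
    (trans (Σ₂≡parity-ones (slice (λ j → (j <ᵇ m) ∧ γ j) 0 n)) (cong parity (sym (cntΠ₁≡ones m))))

  prefix≈chr⊕sₙ : ∀ {m} (m+1<n : suc m < n) → prefix (suc m) ≈ chr⊕sₙ m+1<n (β (suc m))
  prefix≈chr⊕sₙ {m} m+1<n = ⟦⟧ᶠ≈ (_<ᵇ suc m) _
    (λ a a<n∸1 → trans (<ᵇ-suc-xor (toℕ a) m) (sym (chr⊕sₙ-path m+1<n (β (suc m)) a a<n∸1)))
    (sym (chr⊕sₙ-sₙ m+1<n (β (suc m))))

  ∣_∣ᶠ : (ℕ → Bool) → ℕ
  ∣ c ∣ᶠ = ones (slice c 0 n)

  ∣<ᵇ∣ᶠ : ∀ m → m ≤ n → ∣ _<ᵇ m ∣ᶠ ≡ m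
  ∣<ᵇ∣ᶠ m m≤n = ones-slice-< m n 0 m≤n

  ∣not<ᵇ∣ᶠ : ∀ m → ∣ not ∘ (_<ᵇ m) ∣ᶠ + ∣ _<ᵇ m ∣ᶠ ≡ n
  ∣not<ᵇ∣ᶠ m = trans (cong (λ z → ones z + ∣ _<ᵇ m ∣ᶠ) (sym (map-not-slice (_<ᵇ m) 0 n)))
                     (trans (ones-map-not (slice (_<ᵇ m) 0 n)) (length-slice _ 0 n))

module OddΠ₁ {n : ℕ} (S : Graph n) (n≥2 : 2 ≤ n) (path : InducedPathPrefix S)
             (p-odd : parity (Basis.p S n≥2 path) ≡ true) where

  open Basis S n≥2 path public

  Σ₂ʳ-γ : Σ₂ʳ γ 0 n ≡ true
  Σ₂ʳ-γ = trans (Σ₂ʳ≡Σ₂-slice γ 0 n) (trans (Σ₂≡parity-ones Γ) p-odd)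

  ⟦⟧ᶠ-vertex-coord : ∀ c {x} (x+1<n : suc x < n) → ⟦ c ⟧ᶠ (vertex x+1<n) ≡ c x xor c (suc x)
  ⟦⟧ᶠ-vertex-coord c x+1<n =
    trans (⟦⟧ᶠ-path-coord c _ (subst (λ z → suc z < n) (sym (toℕ-vertex x+1<n)) x+1<n))
          (cong (λ z → c z xor c (suc z)) (toℕ-vertex x+1<n))

  -- The path coordinates force c and c′ to differ by a constant d; the sₙ coordinate then
  -- gives d · |Π₁| = 0, so d = 0 because |Π₁| is odd.
  ⟦⟧ᶠ-injective : ∀ c c′ → ⟦ c ⟧ᶠ ≈ ⟦ c′ ⟧ᶠ → ∀ j → j < n → c j ≡ c′ j
  ⟦⟧ᶠ-injective c c′ c≈c′ j j<n = xor≡false⇒≡ (trans (d-const j j<n) d₀≡false)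
    where
    d : ℕ → Bool
    d j = c j xor c′ j
    d-step : ∀ x → suc x < n → d x ≡ d (suc x)
    d-step x x+1<n = xor≡false⇒≡ (trans (interchange (c x) (c′ x) (c (suc x)) (c′ (suc x)))
      (≡⇒xor≡false (trans (sym (⟦⟧ᶠ-vertex-coord c x+1<n)) (trans (c≈c′ _) (⟦⟧ᶠ-vertex-coord c′ x+1<n)))))
    d-const : ∀ j → j < n → d j ≡ d 0
    d-const zero    _       = refl
    d-const (suc j) j+1<n   = trans (sym (d-step j j+1<n)) (d-const j (lower j+1<n))
    sₙ-coord : Σ₂ʳ (λ j → d j ∧ γ j) 0 n ≡ false
    sₙ-coord = trans (Σ₂ʳ-cong _ _ 0 n (λ j _ _ → ∧-distribʳ-xor (γ j) (c j) (c′ j)))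
      (trans (Σ₂ʳ-xor _ _ 0 n) (≡⇒xor≡false (trans (sym (⟦⟧ᶠ-sₙ-coord c)) (trans (c≈c′ sₙ) (⟦⟧ᶠ-sₙ-coord c′)))))
    d₀≡false : d 0 ≡ false
    d₀≡false with d 0 in d₀
    ... | false = refl
    ... | true  = ⊥-elim (true≢false (trans (sym Σ₂ʳ-γ)
                    (trans (Σ₂ʳ-cong _ _ 0 n (λ j _ j<n → cong (_∧ γ j) (sym (trans (d-const j j<n) d₀)))) sₙ-coord)))

  ⟦⟧-ones-unique : ∀ bs bs′ → length bs ≡ n → length bs′ ≡ n → ⟦ bs ⟧ ≈ ⟦ bs′ ⟧ → ones bs ≡ ones bs′
  ⟦⟧-ones-unique bs bs′ bs≡n bs′≡n bs≈bs′ rewrite ≡slice-at bs bs≡n | ≡slice-at bs′ bs′≡n =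
    cong ones (slice-cong _ _ 0 n (λ j _ j<n → ⟦⟧ᶠ-injective (at bs 0) (at bs′ 0) bs≈bs′ j j<n))

  coordᴺ : Vec₂ n → ℕ → Bool
  coordᴺ u x with x <? n
  ... | yes x<n = u (fromℕ< x<n)
  ... | no  _   = false

  coordᴺ-toℕ : ∀ u (a : Fin n) → coordᴺ u (toℕ a) ≡ u a
  coordᴺ-toℕ u a with toℕ a <? n
  ... | yes a<n = cong u (fromℕ<-toℕ a a<n)
  ... | no  a≮n = ⊥-elim (a≮n (toℕ<n a))

  partialSum : Vec₂ n → ℕ → Bool
  partialSum u zero    = false
  partialSum u (suc x) = partialSum u x xor coordᴺ u x

  partialSum-path : ∀ u (a : Fin n) → partialSum u (toℕ a) xor partialSum u (suc (toℕ a)) ≡ u a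
  partialSum-path u a = trans (xor-cancelˡ (partialSum u (toℕ a)) _) (coordᴺ-toℕ u a)

  -- The partial sums of u solve the path coordinates; their complement solves them too and,
  -- |Π₁| being odd, has the other sₙ coordinate.
  ⟦⟧ᶠ-surjective : ∀ u → Σ (ℕ → Bool) λ c → ⟦ c ⟧ᶠ ≈ u
  ⟦⟧ᶠ-surjective u with Σ₂ʳ (λ j → partialSum u j ∧ γ j) 0 n ≟ᴮ u sₙ
  ... | yes on-sₙ = partialSum u , ⟦⟧ᶠ≈ (partialSum u) u (λ a _ → partialSum-path u a) on-sₙ
  ... | no  off-sₙ = not ∘ partialSum u , ⟦⟧ᶠ≈ (not ∘ partialSum u) u
          (λ a _ → trans (xor-annihilates-not (partialSum u (toℕ a)) _) (partialSum-path u a))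
          (trans (Σ₂ʳ-cong _ _ 0 n (λ j _ _ → not-∧ (partialSum u j) (γ j)))
            (trans (Σ₂ʳ-xor _ _ 0 n) (trans (cong (_xor Σ₂ʳ (λ j → partialSum u j ∧ γ j) 0 n) Σ₂ʳ-γ) (≢⇒not≡ off-sₙ))))
    where ≢⇒not≡ : ∀ {x y} → x ≢ y → not x ≡ y
          ≢⇒not≡ {true}  {true}  x≢y = ⊥-elim (x≢y refl)
          ≢⇒not≡ {true}  {false} _   = refl
          ≢⇒not≡ {false} {true}  _   = refl
          ≢⇒not≡ {false} {false} x≢y = ⊥-elim (x≢y refl)

  suffix≈chr⊕sₙ : ∀ {m} (m+1<n : suc m < n) → ⟦ not ∘ (_<ᵇ suc m) ⟧ᶠ ≈ chr⊕sₙ m+1<n (not (β (suc m)))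
  suffix≈chr⊕sₙ {m} m+1<n = ⟦⟧ᶠ≈ (not ∘ (_<ᵇ suc m)) _
    (λ a a<n∸1 → trans (xor-annihilates-not (toℕ a <ᵇ suc m) _)
                   (trans (<ᵇ-suc-xor (toℕ a) m) (sym (chr⊕sₙ-path m+1<n (not (β (suc m))) a a<n∸1))))
    (trans (Σ₂ʳ-cong _ _ 0 n (λ j _ _ → not-∧ (j <ᵇ suc m) (γ j)))
      (trans (Σ₂ʳ-xor _ _ 0 n) (trans (cong (_xor β (suc m)) Σ₂ʳ-γ) (sym (chr⊕sₙ-sₙ m+1<n (not (β (suc m))))))))

  all≈chr-sₙ : ⟦ (λ _ → true) ⟧ᶠ ≈ chr sₙ
  all≈chr-sₙ = ⟦⟧ᶠ≈ (λ _ → true) (chr sₙ) (λ a a<n∸1 → sym (chr-sₙ-path a a<n∸1)) (trans Σ₂ʳ-γ (sym (≡ᵇ-refl (toℕ sₙ))))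

  ∣all∣ᶠ : ∣ (λ _ → true) ∣ᶠ ≡ n
  ∣all∣ᶠ = ones-slice-true 0 n

  chr⊕sₙ-false : ∀ {m} (m+1<n : suc m < n) → chr⊕sₙ m+1<n false ≈ chr (vertex m+1<n)
  chr⊕sₙ-false m+1<n a = xor-identityʳ _

  prefix-unit : ∀ {m} (m+1<n : suc m < n) → parity (cntΠ₁ S (suc m)) ≡ false → prefix (suc m) ≈ chr (vertex m+1<n)
  prefix-unit {m} m+1<n even = ≈-trans (prefix≈chr⊕sₙ m+1<n)
    (≈-trans (≡⇒≈ (cong (chr⊕sₙ m+1<n) (trans (β≡parity-cntΠ₁ (suc m)) even))) (chr⊕sₙ-false m+1<n))

  suffix-unit : ∀ {m} (m+1<n : suc m < n) → parity (cntΠ₁ S (suc m)) ≡ true → ⟦ not ∘ (_<ᵇ suc m) ⟧ᶠ ≈ chr (vertex m+1<n)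
  suffix-unit {m} m+1<n odd = ≈-trans (suffix≈chr⊕sₙ m+1<n)
    (≈-trans (≡⇒≈ (cong (chr⊕sₙ m+1<n ∘ not) (trans (β≡parity-cntΠ₁ (suc m)) odd))) (chr⊕sₙ-false m+1<n))

  ∣suffix∣ᶠ : ∀ {m} → suc m < n → ∣ not ∘ (_<ᵇ suc m) ∣ᶠ + suc m ≡ n
  ∣suffix∣ᶠ {m} m+1<n = trans (cong (∣ not ∘ (_<ᵇ suc m) ∣ᶠ +_) (sym (∣<ᵇ∣ᶠ (suc m) (<⇒≤ m+1<n)))) (∣not<ᵇ∣ᶠ (suc m))

  chr-in-I : ∀ b → Σ (List Bool) λ bs → length bs ≡ n × ⟦ bs ⟧ ≈ chr b × Iset S (ones bs)
  chr-in-I b with path-or-sₙ b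
  ... | inj₂ refl = slice (λ _ → true) 0 n , length-slice _ 0 n , all≈chr-sₙ ,
                    subst (Iset S) (sym ∣all∣ᶠ) ((≤-trans (s≤s z≤n) n≥2 , ≤-refl) , inj₂ (inj₁ refl))
  ... | inj₁ b+1<n with parity (cntΠ₁ S (suc (toℕ b))) in parity≡
  ...   | false = slice (_<ᵇ suc (toℕ b)) 0 n , length-slice _ 0 n ,
                  ≈-trans (prefix-unit b+1<n parity≡) (≡⇒≈ (cong chr (fromℕ<-toℕ b _))) ,
                  subst (Iset S) (sym (∣<ᵇ∣ᶠ (suc (toℕ b)) (<⇒≤ b+1<n))) ((s≤s z≤n , <⇒≤ b+1<n) , inj₁ parity≡)
  ...   | true  = slice (not ∘ (_<ᵇ suc (toℕ b))) 0 n , length-slice _ 0 n ,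
                  ≈-trans (suffix-unit b+1<n parity≡) (≡⇒≈ (cong chr (fromℕ<-toℕ b _))) ,
                  (1≤∣suffix∣ , ∣suffix∣≤n) , inj₂ (inj₂ (subst (λ k → parity (cntΠ₁ S k) ≡ true) (sym n∸∣suffix∣) parity≡))
    where ∣suffix∣+ : ∣ not ∘ (_<ᵇ suc (toℕ b)) ∣ᶠ + suc (toℕ b) ≡ n
          ∣suffix∣+ = ∣suffix∣ᶠ b+1<n
          n∸∣suffix∣ : n ∸ ∣ not ∘ (_<ᵇ suc (toℕ b)) ∣ᶠ ≡ suc (toℕ b)
          n∸∣suffix∣ = trans (cong (_∸ ∣ not ∘ (_<ᵇ suc (toℕ b)) ∣ᶠ) (sym ∣suffix∣+)) (m+n∸m≡n ∣ not ∘ (_<ᵇ suc (toℕ b)) ∣ᶠ (suc (toℕ b)))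
          ∣suffix∣≤n : ∣ not ∘ (_<ᵇ suc (toℕ b)) ∣ᶠ ≤ n
          ∣suffix∣≤n = subst (∣ not ∘ (_<ᵇ suc (toℕ b)) ∣ᶠ ≤_) ∣suffix∣+ (m≤m+n _ _)
          1≤∣suffix∣ : 1 ≤ ∣ not ∘ (_<ᵇ suc (toℕ b)) ∣ᶠ
          1≤∣suffix∣ with ∣ not ∘ (_<ᵇ suc (toℕ b)) ∣ᶠ | ∣suffix∣+
          ... | zero  | b+1≡n = ⊥-elim (<-irrefl b+1≡n b+1<n)
          ... | suc _ | _     = s≤s z≤n

  I-chr : ∀ j → Iset S j → Σ (List Bool) λ bs → Σ (Fin n) λ b → length bs ≡ n × ⟦ bs ⟧ ≈ chr b × ones bs ≡ j
  I-chr j (_ , inj₂ (inj₁ refl)) = slice (λ _ → true) 0 n , sₙ , length-slice _ 0 n , all≈chr-sₙ , ∣all∣ᶠ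
  I-chr j ((_ , j≤n) , inj₁ even) with j <? n
  ... | no j≮n = slice (λ _ → true) 0 n , sₙ , length-slice _ 0 n , all≈chr-sₙ , trans ∣all∣ᶠ (≤-antisym (≮⇒≥ j≮n) j≤n)
  I-chr (suc m) ((_ , j≤n) , inj₁ even) | yes m+1<n =
    slice (_<ᵇ suc m) 0 n , vertex m+1<n , length-slice _ 0 n , prefix-unit m+1<n even , ∣<ᵇ∣ᶠ (suc m) j≤n
  I-chr j ((1≤j , j≤n) , inj₂ (inj₂ odd)) = from-suffix (n ∸ j) refl
    where
    from-suffix : ∀ k → n ∸ j ≡ k → Σ (List Bool) λ bs → Σ (Fin n) λ b → length bs ≡ n × ⟦ bs ⟧ ≈ chr b × ones bs ≡ j
    from-suffix zero    n∸j≡0 =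
      ⊥-elim (true≢false (trans (sym odd) (trans (cong (parity ∘ cntΠ₁ S) n∸j≡0) (cong parity (cntΠ₁≡0)))))
      where cntΠ₁≡0 : cntΠ₁ S 0 ≡ 0
            cntΠ₁≡0 = trans (cntΠ₁≡ones 0) (ones-slice-false 0 n)
    from-suffix (suc m) n∸j≡m+1 =
      slice (not ∘ (_<ᵇ suc m)) 0 n , vertex m+1<n , length-slice _ 0 n ,
      suffix-unit m+1<n (subst (λ k → parity (cntΠ₁ S k) ≡ true) n∸j≡m+1 odd) ,
      (begin
        ∣ not ∘ (_<ᵇ suc m) ∣ᶠ                  ≡⟨ sym (m+n∸n≡m _ (suc m)) ⟩
        ∣ not ∘ (_<ᵇ suc m) ∣ᶠ + suc m ∸ suc m  ≡⟨ cong (_∸ suc m) (∣suffix∣ᶠ m+1<n) ⟩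
        n ∸ suc m                               ≡⟨ cong (n ∸_) (sym n∸j≡m+1) ⟩
        n ∸ (n ∸ j)                             ≡⟨ m∸[m∸n]≡n j≤n ⟩
        j                                       ∎)
      where open ≡-Reasoning
            m+1<n : suc m < n
            m+1<n = subst (_< n) n∸j≡m+1 (∸-monoʳ-< {n} {j} {0} 1≤j j≤n)

module Orbits {n : ℕ} (S : Graph n) (n≥2 : 2 ≤ n) (path : InducedPathPrefix S)
              (p-odd : parity (Basis.p S n≥2 path) ≡ true)
              (p≥3 : 3 ≤ Basis.p S n≥2 path) (q≥3 : 3 ≤ Basis.q S n≥2 path) where

  open OddΠ₁ S n≥2 path p-odd public

  ones-map-not-Γ : ones (map not Γ) ≡ q
  ones-map-not-Γ = cong ones (map-not-slice γ 0 n)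

  ones-flip-sₙ : ∀ bs → length bs ≡ n → ones (xorᴸ bs Γᶜ) + ones bs ≡ ones (andᴸ bs Γ) + ones (andᴸ bs Γ) + q
  ones-flip-sₙ bs bs≡n =
    subst (λ g → ones (xorᴸ bs g) + ones bs ≡ ones (andᴸ bs Γ) + ones (andᴸ bs Γ) + ones g) (map-not-slice γ 0 n)
          (ones-xor-not bs Γ (trans bs≡n (sym (length-slice γ 0 n))))

  length-xorᴸ-Γᶜ : ∀ bs → length bs ≡ n → length (xorᴸ bs Γᶜ) ≡ n
  length-xorᴸ-Γᶜ bs bs≡n = trans (length-xorᴸ bs Γᶜ (trans bs≡n (sym (length-slice _ 0 n)))) bs≡n

  -- A record, so that j and k can be inferred from a proof of j ∼ k
  record _∼_ (j k : ℕ) : Set where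
    constructor reach
    field unreach : Reach S (prefix j) (prefix k)
  open _∼_

  ∼-trans : ∀ {j k l} → j ∼ k → k ∼ l → j ∼ l
  ∼-trans (reach r) (reach r′) = reach (Reach-trans S r r′)

  ∼-sym : ∀ {j k} → j ∼ k → k ∼ j
  ∼-sym (reach r) = reach (Reach-sym S r)

  ∼-reflexive : ∀ {j k} → j ≡ k → j ∼ k
  ∼-reflexive refl = reach (Reach-≈ S ≈-refl)

  Reach-prefix-ones : ∀ bs → length bs ≡ n → ∀ {k} → ones bs ≡ k → Reach S ⟦ bs ⟧ (prefix k)
  Reach-prefix-ones bs bs≡n refl = Reach-prefix bs bs≡n

  -- Choose t coordinates in Π₁ and s in Π₀, then flip sₙ: the s coordinates of Π₀ become the other w.
  reflect : ∀ t s w → parity t ≡ true → t ≤ p → s + w ≡ q → (t + s) ∼ (t + w)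
  reflect t s w t-odd t≤p s+w≡q = reach $
    Reach-trans S (Reach-sym S (Reach-prefix-ones bs bs≡n ones-bs))
            (Reach-trans S (Reach-flip S sₙ (flip-sₙ-lit bs bs≡n lit))
                           (Reach-prefix-ones (xorᴸ bs Γᶜ) (length-xorᴸ-Γᶜ bs bs≡n) ones-bs′))
    where
    bs : List Bool
    bs = choose Γ t s
    bs≡n : length bs ≡ n
    bs≡n = trans (length-choose Γ t s) (length-slice γ 0 n)
    ones-bs : ones bs ≡ t + s
    ones-bs = ones-choose Γ t s t≤p (subst (s ≤_) (sym ones-map-not-Γ) (subst (s ≤_) s+w≡q (m≤m+n s w)))
    ones-and : ones (andᴸ bs Γ) ≡ t
    ones-and = ones-and-choose Γ t s t≤p
    lit : ⟦ bs ⟧ sₙ ≡ true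
    lit = trans (⟦⟧-sₙ-coord bs bs≡n) (trans (cong parity ones-and) t-odd)
    ones-bs′ : ones (xorᴸ bs Γᶜ) ≡ t + w
    ones-bs′ = +-cancelʳ-≡ (t + s) _ _ (begin
      ones (xorᴸ bs Γᶜ) + (t + s)   ≡⟨ cong (ones (xorᴸ bs Γᶜ) +_) (sym ones-bs) ⟩
      ones (xorᴸ bs Γᶜ) + ones bs   ≡⟨ ones-flip-sₙ bs bs≡n ⟩
      ones (andᴸ bs Γ) + ones (andᴸ bs Γ) + q   ≡⟨ cong (λ z → z + z + q) ones-and ⟩
      t + t + q                     ≡⟨ cong (t + t +_) (sym s+w≡q) ⟩
      t + t + (s + w)               ≡⟨ rearrange t s w ⟩
      (t + w) + (t + s)             ∎)
      where open ≡-Reasoning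
            rearrange : ∀ t s w → t + t + (s + w) ≡ (t + w) + (t + s)
            rearrange = solve-∀

  -- Two reflections whose centres differ by 2 make a translation by 4.
  shift4 : ∀ t x → parity t ≡ true → t + 2 ≤ p → x + 2 ≤ q → (t + 4 + x) ∼ (t + x)
  shift4 t x t-odd t+2≤p x+2≤q with m≤n⇒∃[o]m+o≡n x+2≤q
  ... | y , x+2+y≡q = ∼-trans (∼-reflexive (e₁ t x))
    (∼-trans (reflect (t + 2) (x + 2) y t+2-odd t+2≤p x+2+y≡q)
      (∼-trans (∼-reflexive (e₂ t y)) (reflect t (y + 2) x t-odd (≤-trans (m≤m+n t 2) t+2≤p) (trans (e₃ x y) x+2+y≡q))))
    where
    t+2-odd : parity (t + 2) ≡ true
    t+2-odd = trans (parity-+ t 2) (trans (xor-identityʳ (parity t)) t-odd)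
    e₁ : ∀ t x → t + 4 + x ≡ t + 2 + (x + 2)
    e₁ = solve-∀
    e₂ : ∀ t y → t + 2 + y ≡ t + (y + 2)
    e₂ = solve-∀
    e₃ : ∀ x y → y + 2 + x ≡ x + 2 + y
    e₃ = solve-∀

  ∼-cong : ∀ {j j′ k k′} → j ≡ j′ → k ≡ k′ → j ∼ k → j′ ∼ k′
  ∼-cong refl refl j∼k = j∼k

  p≡odd+2 : Σ ℕ λ t → parity t ≡ true × t + 2 ≡ p
  p≡odd+2 with parity-true⇒odd p p-odd
  ... | suc c , p≡ = suc (c + c) , parity-odd c , trans (rearrange c) (sym p≡)
    where rearrange : ∀ c → suc (c + c) + 2 ≡ suc (suc c + suc c)
          rearrange = solve-∀
  ... | zero , p≡1 = ⊥-elim (<-irrefl (sym p≡1) (≤-trans (s≤s (s≤s z≤n)) p≥3))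

  -- Pick t odd with t ≤ k, t + 2 ≤ p and k + 2 ≤ t + q, and translate around it.
  ∼-+4 : ∀ k → 1 ≤ k → 4 + k ≤ n → (4 + k) ∼ k
  ∼-+4 k 1≤k 4+k≤n with k + 2 ≤? p | even-or-odd k
  ... | yes k+2≤p | inj₂ (a , refl) =
    ∼-cong (e a) (+-identityʳ k) (shift4 k 0 (parity-odd a) k+2≤p (≤-trans (s≤s (s≤s z≤n)) q≥3))
    where e : ∀ a → suc (a + a) + 4 + 0 ≡ 4 + suc (a + a)
          e = solve-∀
  ... | yes k+2≤p | inj₁ (suc b , refl) =
    ∼-cong (e₁ b) (e₂ b) (shift4 (suc (b + b)) 1 (parity-odd b) t+2≤p q≥3)
    where e₁ : ∀ b → suc (b + b) + 4 + 1 ≡ 4 + (suc b + suc b)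
          e₁ = solve-∀
          e₂ : ∀ b → suc (b + b) + 1 ≡ suc b + suc b
          e₂ = solve-∀
          e₃ : ∀ b → suc b + suc b + 2 ≡ suc (b + b) + 2 + 1
          e₃ = solve-∀
          t+2≤p : suc (b + b) + 2 ≤ p
          t+2≤p = ≤-trans (m≤m+n _ 1) (subst (_≤ p) (e₃ b) k+2≤p)
  ... | no k+2≰p | _ with p≡odd+2
  ...   | t , t-odd , t+2≡p with m≤n⇒∃[o]m+o≡n t≤k
    where t≤k : t ≤ k
          t≤k = +-cancelʳ-≤ 2 t k (≤-trans (≤-reflexive t+2≡p) (<⇒≤ (≰⇒> k+2≰p)))
  ...     | x , t+x≡k = ∼-cong (trans (e₁ t x) (cong (4 +_) t+x≡k)) t+x≡k (shift4 t x t-odd (≤-reflexive t+2≡p) x+2≤q)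
    where e₁ : ∀ t x → t + 4 + x ≡ 4 + (t + x)
          e₁ = solve-∀
          e₂ : ∀ t x → 4 + (t + x) ≡ x + 2 + (t + 2)
          e₂ = solve-∀
          x+2≤q : x + 2 ≤ q
          x+2≤q = +-cancelʳ-≤ (t + 2) (x + 2) q (begin
            x + 2 + (t + 2)   ≡⟨ sym (e₂ t x) ⟩
            4 + (t + x)       ≡⟨ cong (4 +_) t+x≡k ⟩
            4 + k             ≤⟨ 4+k≤n ⟩
            n                 ≡⟨ sym q+p≡n ⟩
            q + p             ≡⟨ cong (q +_) (sym t+2≡p) ⟩
            q + (t + 2)       ∎)
            where open ≤-Reasoning
  ∼-+4 k () 4+k≤n | yes k+2≤p | inj₁ (zero , refl)

  ∼-reduce₄ : ∀ k → 1 ≤ k → k ≤ n → k ∼ reduce₄ k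
  ∼-reduce₄ (suc (suc (suc (suc (suc k))))) _ k+5≤n =
    ∼-trans (∼-+4 (suc k) (s≤s z≤n) k+5≤n) (∼-reduce₄ (suc k) (s≤s z≤n) (≤-trans (m≤n+m (suc k) 4) k+5≤n))
  ∼-reduce₄ 1 _ _ = ∼-reflexive refl
  ∼-reduce₄ 2 _ _ = ∼-reflexive refl
  ∼-reduce₄ 3 _ _ = ∼-reflexive refl
  ∼-reduce₄ 4 _ _ = ∼-reflexive refl

  n+|Π₁|≡₄q+2 : (n + sizeΠ₁ S) ≡₄ (q + 2)
  n+|Π₁|≡₄q+2 = trans (cong (_% 4) n+|Π₁|≡p+p+q) (odd+odd-≡₄ p q p-odd)
    where n+|Π₁|≡p+p+q : n + sizeΠ₁ S ≡ p + p + q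
          n+|Π₁|≡p+p+q = begin
            n + sizeΠ₁ S   ≡⟨ cong₂ _+_ (sym q+p≡n) sizeΠ₁≡p ⟩
            q + p + p      ≡⟨ rearrange q p ⟩
            p + p + q      ∎
            where open ≡-Reasoning
                  rearrange : ∀ q p → q + p + p ≡ p + p + q
                  rearrange = solve-∀

  -- The second kind of membership in Aᵢ is realised by a reflection with t = 1.
  A-∼ : ∀ i → 1 ≤ i → i ≤ 4 → ∀ k → A S i k → k ∼ i
  A-∼ i 1≤i i≤4 k ((1≤k , k≤n) , inj₁ k≡₄i) =
    ∼-trans (∼-reduce₄ k 1≤k k≤n)
            (∼-reflexive (≡₄⇒≡ (proj₁ (reduce₄-bounds k 1≤k)) (proj₂ (reduce₄-bounds k 1≤k)) 1≤i i≤4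
                               (trans (reduce₄-≡₄ k) k≡₄i)))
  A-∼ (suc i′) _ i≤4 k ((1≤k , k≤n) , inj₂ k+i≡₄c) with m≤n⇒∃[o]m+o≡n (≤-trans (≤-pred i≤4) q≥3)
  ... | w , i′+w≡q =
    ∼-trans (∼-reduce₄ k 1≤k k≤n)
      (∼-trans (∼-reflexive reduce-k≡reduce-1+w)
        (∼-trans (∼-sym (∼-reduce₄ (1 + w) (s≤s z≤n) 1+w≤n))
                 (∼-sym (reflect 1 i′ w refl (≤-trans (s≤s z≤n) p≥3) i′+w≡q))))
    where
    1+w≤n : 1 + w ≤ n
    1+w≤n = begin
      1 + w         ≤⟨ +-monoˡ-≤ w (≤-trans (s≤s z≤n) p≥3) ⟩
      p + w         ≤⟨ +-monoʳ-≤ p (m≤n+m w i′) ⟩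
      p + (i′ + w)  ≡⟨ cong (p +_) i′+w≡q ⟩
      p + q         ≡⟨ +-comm p q ⟩
      q + p         ≡⟨ q+p≡n ⟩
      n             ∎
      where open ≤-Reasoning
    rearrange : ∀ i′ w → i′ + w + 2 ≡ 1 + w + suc i′
    rearrange = solve-∀
    k≡₄1+w : k ≡₄ (1 + w)
    k≡₄1+w = +-cancelʳ-≡₄ k (1 + w) (suc i′)
      (trans k+i≡₄c (trans n+|Π₁|≡₄q+2 (cong (_% 4) (trans (cong (_+ 2) (sym i′+w≡q)) (rearrange i′ w)))))
    reduce-k≡reduce-1+w : reduce₄ k ≡ reduce₄ (1 + w)
    reduce-k≡reduce-1+w with reduce₄-bounds k 1≤k | reduce₄-bounds (1 + w) (s≤s z≤n)
    ... | lo , hi | lo′ , hi′ =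
      ≡₄⇒≡ lo hi lo′ hi′ (trans (reduce₄-≡₄ k) (trans k≡₄1+w (sym (reduce₄-≡₄ (1 + w)))))

  -- Invariant of the moves: the moves at path vertices permute coordinates, and the move at a
  -- lit sₙ changes the simple weight j into j′ with j′ + j ≡ q + 2 ≡ n + |Π₁| (mod 4), which
  -- exchanges the two kinds of membership in Aᵢ.
  Represented : ℕ → Vec₂ n → Set
  Represented i u = Σ (List Bool) λ bs → length bs ≡ n × ⟦ bs ⟧ ≈ u × A S i (ones bs)

  flip-Represented : ∀ i s {u} → Represented i u → Represented i (flip S s u)
  flip-Represented i s (bs , bs≡n , bs≈u , A-bs) with path-or-sₙ s
  ... | inj₁ s<n∸1 =
    swapAt (toℕ s) bs , trans (length-swapAt (toℕ s) bs) bs≡n ,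
    ≈-sym (≈-trans (flip-cong S s (≈-sym bs≈u))
                   (subst (λ v → flip S v ⟦ bs ⟧ ≈ ⟦ swapAt (toℕ s) bs ⟧) (fromℕ<-toℕ s _)
                          (flip-swapAt (toℕ s) s<n∸1 bs (subst (suc (suc (toℕ s)) ≤_) (sym bs≡n) s<n∸1)))) ,
    subst (A S i) (sym (ones-swapAt (toℕ s) bs)) A-bs
  ... | inj₂ refl with ⟦ bs ⟧ sₙ in lit
  ...   | false = bs , bs≡n , ≈-trans bs≈u (≈-sym (flip-fix S sₙ _ (trans (sym (bs≈u sₙ)) lit))) , A-bs
  ...   | true  =
    xorᴸ bs Γᶜ , length-xorᴸ-Γᶜ bs bs≡n ,
    ≈-sym (≈-trans (flip-cong S sₙ (≈-sym bs≈u)) (flip-sₙ-lit bs bs≡n lit)) ,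
    (1≤j′ , j′≤n) , exchange (proj₂ A-bs)
    where
    t j j′ : ℕ
    t = ones (andᴸ bs Γ)
    j = ones bs
    j′ = ones (xorᴸ bs Γᶜ)
    t-odd : parity t ≡ true
    t-odd = trans (sym (⟦⟧-sₙ-coord bs bs≡n)) lit
    1≤j′ : 1 ≤ j′
    1≤j′ with parity-true⇒odd t t-odd
    ... | _ , t≡ = ≤-trans (subst (1 ≤_) (sym t≡) (s≤s z≤n))
                           (subst (λ g → t ≤ ones (xorᴸ bs g)) (map-not-slice γ 0 n) (ones-and≤ones-xor-not bs Γ))
    j′≤n : j′ ≤ n
    j′≤n = subst (j′ ≤_) (length-xorᴸ-Γᶜ bs bs≡n) (ones≤length (xorᴸ bs Γᶜ))
    j′+j≡₄c : (j′ + j) ≡₄ (n + sizeΠ₁ S)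
    j′+j≡₄c = trans (cong (_% 4) (ones-flip-sₙ bs bs≡n)) (trans (odd+odd-≡₄ t q t-odd) (sym n+|Π₁|≡₄q+2))
    exchange : j ≡₄ i ⊎ (j + i) ≡₄ (n + sizeΠ₁ S) → j′ ≡₄ i ⊎ (j′ + i) ≡₄ (n + sizeΠ₁ S)
    exchange (inj₁ j≡₄i)   = inj₂ (trans (+-congˡ-≡₄ i j j′ (sym j≡₄i)) j′+j≡₄c)
    exchange (inj₂ j+i≡₄c) = inj₁ (+-cancelʳ-≡₄ j′ i j (trans j′+j≡₄c (trans (sym j+i≡₄c) (cong (_% 4) (+-comm j i)))))

  applyWord-Represented : ∀ i ws {u} → Represented i u → Represented i (applyWord S ws u)
  applyWord-Represented i []       r = r
  applyWord-Represented i (s ∷ ws) r = flip-Represented i s (applyWord-Represented i ws r)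

  Reach-Represented : ∀ i {u v} → Reach S u v → Represented i u → Represented i v
  Reach-Represented i (ws , ws-u≈v) r with applyWord-Represented i ws r
  ... | bs , bs≡n , bs≈ , A-bs = bs , bs≡n , ≈-trans bs≈ ws-u≈v , A-bs

  Reach-prefix-class : ∀ i → 1 ≤ i → i ≤ 4 → ∀ {u} → Represented i u → Reach S u (prefix i)
  Reach-prefix-class i 1≤i i≤4 (bs , bs≡n , bs≈u , A-bs) =
    Reach-trans S (Reach-≈ S (≈-sym bs≈u))
      (Reach-trans S (Reach-prefix bs bs≡n) (unreach (A-∼ i 1≤i i≤4 (ones bs) A-bs)))

  OrbitIsU : Vec₂ n → ℕ → Set
  OrbitIsU u i = ∀ v → (Reach S u v → InU S (A S i) v) × (InU S (A S i) v → Reach S u v)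

  orbit≡U : ∀ i → 1 ≤ i → i ≤ 4 → ∀ {u} → Represented i u → OrbitIsU u i
  orbit≡U i 1≤i i≤4 {u} r v = to , from
    where
    to : Reach S u v → InU S (A S i) v
    to u↝v with Reach-Represented i u↝v r
    ... | bs′ , bs′≡n , bs′≈v , A-bs′ = ⟦⟧→InU {A S i} bs′ bs′≡n bs′≈v A-bs′
    from : InU S (A S i) v → Reach S u v
    from v∈U = Reach-trans S (Reach-prefix-class i 1≤i i≤4 r)
                             (Reach-sym S (Reach-prefix-class i 1≤i i≤4 (InU→⟦⟧ {A S i} v∈U)))

  6≤n : 6 ≤ n
  6≤n = subst (6 ≤_) q+p≡n (+-mono-≤ q≥3 p≥3)

  ≤4⇒≤n : ∀ {i} → i ≤ 4 → i ≤ n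
  ≤4⇒≤n i≤4 = ≤-trans i≤4 (≤-trans (m≤m+n 4 2) 6≤n)

  prefix-nonzero : ∀ i → 1 ≤ i → i ≤ n → ¬ (prefix i ≈ zeroV)
  prefix-nonzero i 1≤i i≤n prefix≈0 = <-irrefl (sym i≡0) 1≤i
    where i≡0 : i ≡ 0
          i≡0 = begin
            i                                   ≡⟨ sym (∣<ᵇ∣ᶠ i i≤n) ⟩
            ones (slice (_<ᵇ i) 0 n)            ≡⟨ ⟦⟧-ones-unique (slice (_<ᵇ i) 0 n) (slice (λ _ → false) 0 n)
                                                     (length-slice _ 0 n) (length-slice _ 0 n)
                                                     (≈-trans prefix≈0 (≈-sym (lincomb-ones≡0 (slice (λ _ → false) 0 n) π 0 (ones-slice-false 0 n)))) ⟩
            ones (slice (λ _ → false) 0 n)      ≡⟨ ones-slice-false 0 n ⟩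
            0                                   ∎
            where open ≡-Reasoning

  prefix-Represented : ∀ i → 1 ≤ i → i ≤ 4 → Represented i (prefix i)
  prefix-Represented i 1≤i i≤4 =
    slice (_<ᵇ i) 0 n , length-slice _ 0 n , ≈-refl ,
    subst (A S i) (sym (∣<ᵇ∣ᶠ i (≤4⇒≤n i≤4))) ((1≤i , ≤4⇒≤n i≤4) , inj₁ refl)

  classify : ∀ u → u ≈ zeroV ⊎ Σ ℕ λ i → (1 ≤ i × i ≤ 4) × Represented i u
  classify u with ⟦⟧ᶠ-surjective u
  ... | c , c≈u with ones (slice c 0 n) in ones≡
  ...   | zero  = inj₁ (≈-trans (≈-sym c≈u) (lincomb-ones≡0 (slice c 0 n) π 0 ones≡))
  ...   | suc k = inj₂ (reduce₄ (suc k) , reduce₄-bounds (suc k) (s≤s z≤n) ,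
                        slice c 0 n , length-slice c 0 n , c≈u ,
                        subst (A S (reduce₄ (suc k))) (sym ones≡)
                              ((s≤s z≤n , k+1≤n) , inj₁ (sym (reduce₄-≡₄ (suc k)))))
    where k+1≤n : suc k ≤ n
          k+1≤n = subst (_≤ n) ones≡ (subst (ones (slice c 0 n) ≤_) (length-slice c 0 n) (ones≤length (slice c 0 n)))

  prefix-linked : ∀ x y → 1 ≤ x → x ≤ 4 → y ≤ 4 → Reach S (prefix x) (prefix y) → A S x y
  prefix-linked x y 1≤x x≤4 y≤4 x↝y with InU→⟦⟧ {A S x} (proj₁ (orbit≡U x 1≤x x≤4 (prefix-Represented x 1≤x x≤4) (prefix y)) x↝y)
  ... | bs , bs≡n , bs≈y , A-bs =
    subst (A S x) (trans (⟦⟧-ones-unique bs (slice (_<ᵇ y) 0 n) bs≡n (length-slice _ 0 n) bs≈y) (∣<ᵇ∣ᶠ y (≤4⇒≤n y≤4))) A-bs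

  linkedᵇ : ℕ → ℕ → ℕ → Bool
  linkedᵇ c i k = (k % 4 ≡ᵇ i % 4) ∨ ((k + i) % 4 ≡ᵇ c)

  A⇒linkedᵇ : ∀ {c i k} → (n + sizeΠ₁ S) % 4 ≡ c → A S i k → T (linkedᵇ c i k)
  A⇒linkedᵇ {c} {i} {k} c≡ (_ , inj₁ k≡₄i)   = Equivalence.from T-∨ (inj₁ (≡⇒≡ᵇ (k % 4) (i % 4) k≡₄i))
  A⇒linkedᵇ {c} {i} {k} c≡ (_ , inj₂ k+i≡₄c) = Equivalence.from T-∨ (inj₂ (≡⇒≡ᵇ ((k + i) % 4) c (trans k+i≡₄c c≡)))

  linkedᵇ⇒A : ∀ {c i k} → (n + sizeΠ₁ S) % 4 ≡ c → 1 ≤ k → k ≤ n → T (linkedᵇ c i k) → A S i k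
  linkedᵇ⇒A {c} {i} {k} c≡ 1≤k k≤n linked with Equivalence.to T-∨ linked
  ... | inj₁ k≡₄i   = (1≤k , k≤n) , inj₁ (≡ᵇ⇒≡ (k % 4) (i % 4) k≡₄i)
  ... | inj₂ k+i≡₄c = (1≤k , k≤n) , inj₂ (trans (≡ᵇ⇒≡ ((k + i) % 4) c k+i≡₄c) (sym c≡))

  NumOrbits-from : ∀ {c} → (n + sizeΠ₁ S) % 4 ≡ c → ∀ k (r : Fin k → ℕ) →
    (∀ a → 1 ≤ r a × r a ≤ 4) → (∀ a b → T (linkedᵇ c (r a) (r b)) → a ≡ b) →
    (∀ i → 1 ≤ i → i ≤ 4 → Σ (Fin k) λ a → T (linkedᵇ c i (r a))) → NumOrbits S (suc k)
  NumOrbits-from {c} c≡ k r r-bounds r-distinct r-cover = rep , distinct , cover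
    where
    rep : Fin (suc k) → Vec₂ n
    rep fzero    = zeroV
    rep (fsuc a) = prefix (r a)
    nonzero : ∀ a → ¬ (prefix (r a) ≈ zeroV)
    nonzero a = prefix-nonzero (r a) (proj₁ (r-bounds a)) (≤4⇒≤n (proj₂ (r-bounds a)))
    distinct : ∀ a b → Reach S (rep a) (rep b) → a ≡ b
    distinct fzero    fzero    _         = refl
    distinct fzero    (fsuc b) (ws , h)  = ⊥-elim (nonzero b (≈-trans (≈-sym h) (applyWord-zeroV S ws)))
    distinct (fsuc a) fzero    a↝0       = ⊥-elim (nonzero a (Reach-zeroV S a↝0 ≈-refl))
    distinct (fsuc a) (fsuc b) a↝b       = cong fsuc (r-distinct a b (A⇒linkedᵇ c≡
      (prefix-linked (r a) (r b) (proj₁ (r-bounds a)) (proj₂ (r-bounds a)) (proj₂ (r-bounds b)) a↝b)))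
    cover : ∀ u → ∃ λ a → Reach S (rep a) u
    cover u with classify u
    ... | inj₁ u≈0 = fzero , Reach-≈ S (≈-sym u≈0)
    ... | inj₂ (i , (1≤i , i≤4) , rep-u) with r-cover i 1≤i i≤4
    ...   | a , linked = fsuc a , Reach-trans S (unreach (A-∼ i 1≤i i≤4 (r a) A-i-ra))
                                            (Reach-sym S (Reach-prefix-class i 1≤i i≤4 rep-u))
      where A-i-ra : A S i (r a)
            A-i-ra = linkedᵇ⇒A c≡ (proj₁ (r-bounds a)) (≤4⇒≤n (proj₂ (r-bounds a))) linked

  orbits-c≡1 : (n + sizeΠ₁ S) % 4 ≡ 1 → NumOrbits S 3
  orbits-c≡1 c≡ = NumOrbits-from c≡ 2 r bounds distinct
    (one-to-four (fzero , _) (fsuc fzero , _) (fsuc fzero , _) (fzero , _))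
    where
    r : Fin 2 → ℕ
    r fzero        = 1
    r (fsuc fzero) = 2
    bounds : ∀ a → 1 ≤ r a × r a ≤ 4
    bounds fzero        = s≤s z≤n , s≤s z≤n
    bounds (fsuc fzero) = s≤s z≤n , s≤s (s≤s z≤n)
    distinct : ∀ a b → T (linkedᵇ 1 (r a) (r b)) → a ≡ b
    distinct fzero        fzero        _ = refl
    distinct (fsuc fzero) (fsuc fzero) _ = refl
    distinct fzero        (fsuc fzero) ()
    distinct (fsuc fzero) fzero        ()

  orbits-c≡3 : (n + sizeΠ₁ S) % 4 ≡ 3 → NumOrbits S 3
  orbits-c≡3 c≡ = NumOrbits-from c≡ 2 r bounds distinct
    (one-to-four (fzero , _) (fzero , _) (fsuc fzero , _) (fsuc fzero , _))
    where
    r : Fin 2 → ℕ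
    r fzero        = 1
    r (fsuc fzero) = 3
    bounds : ∀ a → 1 ≤ r a × r a ≤ 4
    bounds fzero        = s≤s z≤n , s≤s z≤n
    bounds (fsuc fzero) = s≤s z≤n , s≤s (s≤s (s≤s z≤n))
    distinct : ∀ a b → T (linkedᵇ 3 (r a) (r b)) → a ≡ b
    distinct fzero        fzero        _ = refl
    distinct (fsuc fzero) (fsuc fzero) _ = refl
    distinct fzero        (fsuc fzero) ()
    distinct (fsuc fzero) fzero        ()

  orbits-c≡0 : (n + sizeΠ₁ S) % 4 ≡ 0 → NumOrbits S 4
  orbits-c≡0 c≡ = NumOrbits-from c≡ 3 r bounds distinct
    (one-to-four (fzero , _) (fsuc fzero , _) (fzero , _) (fsuc (fsuc fzero) , _))
    where
    r : Fin 3 → ℕ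
    r fzero               = 1
    r (fsuc fzero)        = 2
    r (fsuc (fsuc fzero)) = 4
    bounds : ∀ a → 1 ≤ r a × r a ≤ 4
    bounds fzero               = s≤s z≤n , s≤s z≤n
    bounds (fsuc fzero)        = s≤s z≤n , s≤s (s≤s z≤n)
    bounds (fsuc (fsuc fzero)) = s≤s z≤n , s≤s (s≤s (s≤s (s≤s z≤n)))
    distinct : ∀ a b → T (linkedᵇ 0 (r a) (r b)) → a ≡ b
    distinct fzero               fzero               _ = refl
    distinct (fsuc fzero)        (fsuc fzero)        _ = refl
    distinct (fsuc (fsuc fzero)) (fsuc (fsuc fzero)) _ = refl
    distinct fzero               (fsuc fzero)        ()
    distinct fzero               (fsuc (fsuc fzero)) ()
    distinct (fsuc fzero)        fzero               ()
    distinct (fsuc fzero)        (fsuc (fsuc fzero)) ()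
    distinct (fsuc (fsuc fzero)) fzero               ()
    distinct (fsuc (fsuc fzero)) (fsuc fzero)        ()

  orbits-c≡2 : (n + sizeΠ₁ S) % 4 ≡ 2 → NumOrbits S 4
  orbits-c≡2 c≡ = NumOrbits-from c≡ 3 r bounds distinct
    (one-to-four (fzero , _) (fsuc fzero , _) (fsuc (fsuc fzero) , _) (fsuc fzero , _))
    where
    r : Fin 3 → ℕ
    r fzero               = 1
    r (fsuc fzero)        = 2
    r (fsuc (fsuc fzero)) = 3
    bounds : ∀ a → 1 ≤ r a × r a ≤ 4
    bounds fzero               = s≤s z≤n , s≤s z≤n
    bounds (fsuc fzero)        = s≤s z≤n , s≤s (s≤s z≤n)
    bounds (fsuc (fsuc fzero)) = s≤s z≤n , s≤s (s≤s (s≤s z≤n))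
    distinct : ∀ a b → T (linkedᵇ 2 (r a) (r b)) → a ≡ b
    distinct fzero               fzero               _ = refl
    distinct (fsuc fzero)        (fsuc fzero)        _ = refl
    distinct (fsuc (fsuc fzero)) (fsuc (fsuc fzero)) _ = refl
    distinct fzero               (fsuc fzero)        ()
    distinct fzero               (fsuc (fsuc fzero)) ()
    distinct (fsuc fzero)        fzero               ()
    distinct (fsuc fzero)        (fsuc (fsuc fzero)) ()
    distinct (fsuc (fsuc fzero)) fzero               ()
    distinct (fsuc (fsuc fzero)) (fsuc fzero)        ()

  parity-n+|Π₁| : ∀ {c} → (n + sizeΠ₁ S) % 4 ≡ c → parity c ≡ not (parity n)
  parity-n+|Π₁| {c} c≡ = begin
    parity c                          ≡⟨ cong parity (sym c≡) ⟩
    parity ((n + sizeΠ₁ S) % 4)       ≡⟨ parity-%4 (n + sizeΠ₁ S) ⟩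
    parity (n + sizeΠ₁ S)             ≡⟨ parity-+ n (sizeΠ₁ S) ⟩
    parity n xor parity (sizeΠ₁ S)    ≡⟨ cong (parity n xor_) (trans (cong parity sizeΠ₁≡p) p-odd) ⟩
    parity n xor true                 ≡⟨ xor-true (parity n) ⟩
    not (parity n)                    ∎
    where open ≡-Reasoning
          xor-true : ∀ x → x xor true ≡ not x
          xor-true true  = refl
          xor-true false = refl

  NumOrbits-even : n % 2 ≡ 0 → NumOrbits S 3
  NumOrbits-even n%2≡0 with %4-cases (n + sizeΠ₁ S)
  ... | inj₁ c≡0               = ⊥-elim (true≢false (sym (trans (parity-n+|Π₁| c≡0) (cong not (cong (_≡ᵇ 1) n%2≡0)))))
  ... | inj₂ (inj₁ c≡1)        = orbits-c≡1 c≡1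
  ... | inj₂ (inj₂ (inj₁ c≡2)) = ⊥-elim (true≢false (sym (trans (parity-n+|Π₁| c≡2) (cong not (cong (_≡ᵇ 1) n%2≡0)))))
  ... | inj₂ (inj₂ (inj₂ c≡3)) = orbits-c≡3 c≡3

  NumOrbits-odd : n % 2 ≡ 1 → NumOrbits S 4
  NumOrbits-odd n%2≡1 with %4-cases (n + sizeΠ₁ S)
  ... | inj₁ c≡0               = orbits-c≡0 c≡0
  ... | inj₂ (inj₁ c≡1)        = ⊥-elim (true≢false (trans (parity-n+|Π₁| c≡1) (cong not (cong (_≡ᵇ 1) n%2≡1))))
  ... | inj₂ (inj₂ (inj₁ c≡2)) = orbits-c≡2 c≡2
  ... | inj₂ (inj₂ (inj₂ c≡3)) = ⊥-elim (true≢false (trans (parity-n+|Π₁| c≡3) (cong not (cong (_≡ᵇ 1) n%2≡1))))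

  Meets-I : ℕ → Set
  Meets-I i = ∃ λ j → A S i j × Iset S j

  Meets-I? : ∀ i → Dec (Meets-I i)
  Meets-I? i with any? {suc n} (λ f → A? (toℕ f) ×-dec Iset? (toℕ f))
    where
    A? : ∀ j → Dec (A S i j)
    A? j = ((1 ≤? j) ×-dec (j ≤? n)) ×-dec ((j % 4 ≟ i % 4) ⊎-dec ((j + i) % 4 ≟ (n + sizeΠ₁ S) % 4))
    Iset? : ∀ j → Dec (Iset S j)
    Iset? j = ((1 ≤? j) ×-dec (j ≤? n)) ×-dec
              ((parity (cntΠ₁ S j) ≟ᴮ false) ⊎-dec ((j ≟ n) ⊎-dec (parity (cntΠ₁ S (n ∸ j)) ≟ᴮ true)))
  ... | yes (f , Aj×Ij) = yes (toℕ f , Aj×Ij)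
  ... | no  none        = no λ { (j , Aj , Ij) → none (fromℕ< (s≤s (proj₂ (proj₁ Aj))) ,
          subst (λ k → A S i k × Iset S k) (sym (toℕ-fromℕ< (s≤s (proj₂ (proj₁ Aj))))) (Aj , Ij)) }

  some-class-misses-I : ¬ (∀ i → 1 ≤ i → i ≤ 4 → Meets-I i) → Σ ℕ λ i → (1 ≤ i × i ≤ 4) × ¬ Meets-I i
  some-class-misses-I not-all with Meets-I? 1 | Meets-I? 2 | Meets-I? 3 | Meets-I? 4
  ... | no m₁  | _      | _      | _      = 1 , (s≤s z≤n , s≤s z≤n) , m₁
  ... | yes _  | no m₂  | _      | _      = 2 , (s≤s z≤n , s≤s (s≤s z≤n)) , m₂
  ... | yes _  | yes _  | no m₃  | _      = 3 , (s≤s z≤n , s≤s (s≤s (s≤s z≤n))) , m₃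
  ... | yes _  | yes _  | yes _  | no m₄  = 4 , (s≤s z≤n , ≤-refl) , m₄
  ... | yes m₁ | yes m₂ | yes m₃ | yes m₄ = ⊥-elim (not-all (one-to-four m₁ m₂ m₃ m₄))

  weight-prefix : ∀ i → 1 ≤ i → i ≤ 4 → weight (prefix i) ≤ 2
  weight-prefix (suc m) _ i≤4 = ≤-trans (≤-reflexive (weight-cong (prefix≈chr⊕sₙ m+1<n))) (weight-chr⊕sₙ m+1<n (β (suc m)))
    where m+1<n : suc m < n
          m+1<n = ≤-trans (s≤s i≤4) (≤-trans (n≤1+n 5) 6≤n)

  weight≡0 : ∀ {u : Vec₂ n} → u ≈ zeroV → weight u ≡ 0
  weight≡0 u≈0 = trans (weight-cong u≈0) (weight-zeroV {n})

  Reach-nonzero : ∀ i → 1 ≤ i → i ≤ 4 → ∀ v → Reach S (prefix i) v → 1 ≤ weight v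
  Reach-nonzero i 1≤i i≤4 v i↝v with weight v in w≡
  ... | zero  = ⊥-elim (prefix-nonzero i 1≤i (≤4⇒≤n i≤4) (Reach-zeroV S i↝v (weight≡0⇒≈zeroV v w≡)))
  ... | suc _ = s≤s z≤n

  -- Each class containing a simple weight in I contains a unit vector.
  MaxMinWeight-1 : (∀ i → 1 ≤ i → i ≤ 4 → Meets-I i) → MaxMinWeight S 1
  MaxMinWeight-1 all-meet = reach-light , prefix 1 , Reach-nonzero 1 (s≤s z≤n) (s≤s z≤n)
    where
    reach-light : ∀ u → ∃ λ v → Reach S u v × weight v ≤ 1
    reach-light u with classify u
    ... | inj₁ u≈0 = u , Reach-≈ S ≈-refl , ≤-trans (≤-reflexive (weight≡0 u≈0)) z≤n
    ... | inj₂ (i , (1≤i , i≤4) , rep-u) with all-meet i 1≤i i≤4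
    ...   | j , Aj , Ij with I-chr j Ij
    ...     | bs , b , bs≡n , bs≈b , ones≡j =
      chr b , proj₂ (orbit≡U i 1≤i i≤4 rep-u (chr b)) (⟦⟧→InU {A S i} bs bs≡n bs≈b (subst (A S i) (sym ones≡j) Aj)) ,
      ≤-reflexive (weight-chr b)

  -- A class missing I contains no unit vector, while prefix i has weight at most 2.
  MaxMinWeight-2 : ¬ (∀ i → 1 ≤ i → i ≤ 4 → Meets-I i) → MaxMinWeight S 2
  MaxMinWeight-2 not-all with some-class-misses-I not-all
  ... | i₀ , (1≤i₀ , i₀≤4) , misses = reach-light , prefix i₀ , heavy
    where
    reach-light : ∀ u → ∃ λ v → Reach S u v × weight v ≤ 2
    reach-light u with classify u
    ... | inj₁ u≈0 = u , Reach-≈ S ≈-refl , ≤-trans (≤-reflexive (weight≡0 u≈0)) z≤n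
    ... | inj₂ (i , (1≤i , i≤4) , rep-u) =
      prefix i , Reach-prefix-class i 1≤i i≤4 rep-u , weight-prefix i 1≤i i≤4
    heavy : ∀ v → Reach S (prefix i₀) v → 2 ≤ weight v
    heavy v i₀↝v with weight v in w≡ | Reach-nonzero i₀ 1≤i₀ i₀≤4 v i₀↝v
    ... | suc (suc _) | _ = s≤s (s≤s z≤n)
    ... | suc zero    | _ with weight≡1⇒≈chr v w≡
    ...   | b , v≈b with chr-in-I b | InU→⟦⟧ {A S i₀} (proj₁ (orbit≡U i₀ 1≤i₀ i₀≤4 (prefix-Represented i₀ 1≤i₀ i₀≤4) v) i₀↝v)
    ...     | bs′ , bs′≡n , bs′≈b , I-bs′ | bs , bs≡n , bs≈v , A-bs =
      ⊥-elim (misses (ones bs′ , subst (A S i₀) (⟦⟧-ones-unique bs bs′ bs≡n bs′≡n (≈-trans bs≈v (≈-trans v≈b (≈-sym bs′≈b)))) A-bs , I-bs′))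

  nontrivial-orbit : ∀ u → ¬ (u ≈ zeroV) → ∃ λ i → (1 ≤ i × i ≤ 4) × OrbitIsU u i
  nontrivial-orbit u u≉0 with classify u
  ... | inj₁ u≈0 = ⊥-elim (u≉0 u≈0)
  ... | inj₂ (i , (1≤i , i≤4) , rep-u) = i , (1≤i , i≤4) , orbit≡U i 1≤i i≤4 rep-u

  orbit-of-class : ∀ i → 1 ≤ i → i ≤ 4 → ∃ λ u → ¬ (u ≈ zeroV) × OrbitIsU u i
  orbit-of-class i 1≤i i≤4 =
    prefix i , prefix-nonzero i 1≤i (≤4⇒≤n i≤4) , orbit≡U i 1≤i i≤4 (prefix-Represented i 1≤i i≤4)

theorem5p3 : (n : ℕ) (S : Graph n) → 2 ≤ n → Connected S → InducedPathPrefix S →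
    sizeΠ₁ S % 2 ≡ 1 → 3 ≤ sizeΠ₁ S → sizeΠ₁ S + 3 ≤ n →
    ((∀ u → ¬ (u ≈ zeroV) →
        ∃ λ i → (1 ≤ i × i ≤ 4) × (∀ v → (Reach S u v → InU S (A S i) v) × (InU S (A S i) v → Reach S u v)))
     × (∀ i → 1 ≤ i → i ≤ 4 →
        ∃ λ u → ¬ (u ≈ zeroV) × (∀ v → (Reach S u v → InU S (A S i) v) × (InU S (A S i) v → Reach S u v))))
    × ((n % 2 ≡ 0 → NumOrbits S 3) × (n % 2 ≡ 1 → NumOrbits S 4))
    × (((∀ i → 1 ≤ i → i ≤ 4 → ∃ λ j → A S i j × Iset S j) → MaxMinWeight S 1)
      × (¬ (∀ i → 1 ≤ i → i ≤ 4 → ∃ λ j → A S i j × Iset S j) → MaxMinWeight S 2))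
theorem5p3 n S n≥2 _ path |Π₁|-odd 3≤|Π₁| |Π₁|+3≤n =
  (nontrivial-orbit , orbit-of-class) , (NumOrbits-even , NumOrbits-odd) , (MaxMinWeight-1 , MaxMinWeight-2)
  where
  open Basis S n≥2 path using (p; q; q+p≡n; sizeΠ₁≡p)
  p-odd : parity p ≡ true
  p-odd = subst (λ k → parity k ≡ true) sizeΠ₁≡p (cong (_≡ᵇ 1) |Π₁|-odd)
  p≥3 : 3 ≤ p
  p≥3 = subst (3 ≤_) sizeΠ₁≡p 3≤|Π₁|
  q≥3 : 3 ≤ q
  q≥3 = +-cancelˡ-≤ p 3 q (subst₂ _≤_ (cong (_+ 3) sizeΠ₁≡p) (trans (sym q+p≡n) (+-comm q p)) |Π₁|+3≤n)
  open Orbits S n≥2 path p-odd p≥3 q≥3
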